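{- For $n\ge1$ let $P_n=\left[\mathrm{sgn}\left(\sin\left(\frac{i+j}{n+1}\pi\right)\right)\right]_{1\le i,j\le n}$. Then for every $n\ge1$, $P_{2n}$ is invertible and $$\mathrm{per}(P_{2n})=\mathrm{per}(P_{2n}^{ -1})=(-1)^nE_{2n}.$$
   Context: $\mathrm{sgn}$ is the sign function ($\mathrm{sgn}(0)=0$). For an $N\times N$ matrix $A=[a_{i,j}]$, $\mathrm{per}(A)=\sum_{\pi\in\mathfrak S_N}\prod_{i=1}^N a_{i,\pi(i)}$. The Euler numbers $E_n$ are defined by $\sec x+\tan x=\sum_{n\ge0}E_n\frac{x^n}{n!}$. -}

module Defs where

open import Data.Nat as ℕ using (ℕ; zero; suc)
open import Data.Nat.Combinatorics using (_C_)
open import Data.Fin as Fin using (Fin; zero; suc; toℕ)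
open import Data.Fin.Properties using (all?) renaming (_≟_ to _≟F_)
open import Data.Integer as ℤ using (ℤ; +_; -[1+_])
import Data.Rational as ℚ
open ℚ using (ℚ)
open import Data.List using (List; []; _∷_; map; concatMap; filter; foldr; allFin)
open import Data.Vec.Functional as VF using ()
open import Relation.Binary.PropositionalEquality using (_≡_)
open import Relation.Nullary using (Dec; yes; no; _→-dec_)
open import Relation.Nullary.Decidable using (⌊_⌋)
open import Data.Product using (_×_)

sgn : ℤ → ℤ
sgn (+ zero)  = + 0
sgn (+ suc _) = + 1
sgn -[1+ _ ]  = -[1+ 0 ]

-- The matrix P_n, 0-indexed: entry (i,j) (i,j : Fin n) corresponds to
-- the paper's (i+1, j+1).  The paper's entry is
--   sgn (sin (((i+1)+(j+1)) π / (n+1))),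
-- and since 2 ≤ (i+1)+(j+1) ≤ 2n < 2(n+1), the sine is positive, zero or
-- negative exactly when (i+1)+(j+1) is <, =, > n+1.  Hence the entry is
--   sgn ((n+1) - ((i+1)+(j+1))).

P : (n : ℕ) → Fin n → Fin n → ℤ
P n i j = sgn (+ (suc n) ℤ.- + (suc (toℕ i) ℕ.+ suc (toℕ j)))

Σℤ : (N : ℕ) → (Fin N → ℤ) → ℤ
Σℤ zero    f = + 0
Σℤ (suc N) f = f zero ℤ.+ Σℤ N (λ i → f (suc i))

Πℤ : (N : ℕ) → (Fin N → ℤ) → ℤ
Πℤ zero    f = + 1
Πℤ (suc N) f = f zero ℤ.* Πℤ N (λ i → f (suc i))

Σℚ : (N : ℕ) → (Fin N → ℚ) → ℚ
Σℚ zero    f = ℚ.0ℚ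
Σℚ (suc N) f = f zero ℚ.+ Σℚ N (λ i → f (suc i))

Πℚ : (N : ℕ) → (Fin N → ℚ) → ℚ
Πℚ zero    f = ℚ.1ℚ
Πℚ (suc N) f = f zero ℚ.* Πℚ N (λ i → f (suc i))

-- The symmetric group S_N, enumerated as the list of all bijections
-- Fin N → Fin N (an endofunction of a finite set is a bijection iff it
-- is injective).

allFuns : (N M : ℕ) → List (Fin N → Fin M)
allFuns zero    M = (λ ()) ∷ []
allFuns (suc N) M =
  concatMap (λ f → map (λ x → x VF.∷ f) (allFin M)) (allFuns N M)

IsInjective : {N : ℕ} → (Fin N → Fin N) → Set
IsInjective {N} σ = (i j : Fin N) → σ i ≡ σ j → i ≡ j

isInjective? : {N : ℕ} → (σ : Fin N → Fin N) → Dec (IsInjective σ)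
isInjective? σ = all? (λ i → all? (λ j → (σ i ≟F σ j) →-dec (i ≟F _)))

perms : (N : ℕ) → List (Fin N → Fin N)
perms N = filter isInjective? (allFuns N N)

perℤ : {N : ℕ} → (Fin N → Fin N → ℤ) → ℤ
perℤ {N} A = foldr (λ π acc → Πℤ N (λ i → A i (π i)) ℤ.+ acc) (+ 0) (perms N)

perℚ : {N : ℕ} → (Fin N → Fin N → ℚ) → ℚ
perℚ {N} A = foldr (λ π acc → Πℚ N (λ i → A i (π i)) ℚ.+ acc) ℚ.0ℚ (perms N)

toℚ : ℤ → ℚ
toℚ z = z ℚ./ 1

mulℚ : {N : ℕ} → (Fin N → Fin N → ℚ) → (Fin N → Fin N → ℚ) → Fin N → Fin N → ℚ
mulℚ {N} A B i j = Σℚ N (λ k → A i k ℚ.* B k j)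

idℚ : {N : ℕ} → Fin N → Fin N → ℚ
idℚ i j with i ≟F j
... | yes _ = ℚ.1ℚ
... | no  _ = ℚ.0ℚ

IsInverse : {N : ℕ} → (Fin N → Fin N → ℚ) → (Fin N → Fin N → ℚ) → Set
IsInverse A B = (∀ i j → mulℚ A B i j ≡ idℚ i j) × (∀ i j → mulℚ B A i j ≡ idℚ i j)

-- Euler numbers via their exponential generating function
--   sec x + tan x = Σ E_n x^n / n!.
-- Multiplying by cos x (a unit in ℚ[[x]]), this says
--   (Σ E_n x^n/n!) · cos x = 1 + sin x
-- as formal power series, i.e. coefficientwise (binomial convolution):
--   Σ_{k=0}^{n} C(n,k) E_k c_{n-k} = [n = 0] + s_n
-- where cos x = Σ c_m x^m/m!, sin x = Σ s_m x^m/m!.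

sign^ : ℕ → ℤ
sign^ zero          = + 1
sign^ (suc zero)    = -[1+ 0 ]
sign^ (suc (suc k)) = sign^ k

cosCoeff : ℕ → ℤ
cosCoeff zero          = + 1
cosCoeff (suc zero)    = + 0
cosCoeff (suc (suc m)) = ℤ.- cosCoeff m

sinCoeff : ℕ → ℤ
sinCoeff zero          = + 0
sinCoeff (suc zero)    = + 1
sinCoeff (suc (suc m)) = ℤ.- sinCoeff m

δ0 : ℕ → ℤ
δ0 zero    = + 1
δ0 (suc _) = + 0

IsEulerNumbers : (ℕ → ℤ) → Set
IsEulerNumbers E =
  ∀ n → Σℤ (suc n) (λ k → + (n C toℕ k) ℤ.* (E (toℕ k) ℤ.* cosCoeff (n ℕ.∸ toℕ k)))
        ≡ δ0 n ℤ.+ sinCoeff n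

-- Write S_N for the N × N matrix [sgn (j - i)]. Reversing the columns of P_N gives S_N, so
-- per P_N = per S_N =: s_N, and s_N = 0 for odd N because S_N is skew-symmetric. The permanent
-- is affine in each entry, so adding σ = ±1 to the diagonal one entry at a time gives
-- per (S_N + σI) = Σ_k C(N,k) σ^(N-k) s_k; and moving the last column of S_N + I to the front
-- turns it into S_N - I with its first column negated. Hence Σ_k C(2n,k) s_k = [n = 0]. The
-- numbers E_k cos⁽ᵏ⁾(0) satisfy the same relations (they are the even part of
-- (sec x + tan x) cos x = 1 + sin x) and also vanish at odd k; as these relations determine
-- such a sequence, s_2n = (-1)^n E_2n. For even m, [(-1)^(i+j) (P_m)ᵢⱼ] is the inverse of P_m
-- (a computation with alternating sums of sign products), it has the same permanent since
-- rescaling rows and columns by ±1 does not change the permanent, and inverses are unique.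

module Submission where

open import Defs
open import Data.Nat using (ℕ)
open import Data.Integer using (ℤ)

module Sums where

  open import Data.Nat using (ℕ; zero; suc)
  open import Data.Integer using (ℤ; 0ℤ; _+_; _*_)
  open import Data.Integer.Properties using (+-*-semiring; +-identityˡ; +-assoc; *-zeroʳ; *-distribˡ-+)
  open import Data.Fin using (Fin; zero; suc)
  open import Data.List using (List; []; _∷_; foldr; filter; map; concatMap; _++_; tabulate)
  open import Data.Bool using (if_then_else_)
  open import Function using (_∘_)
  open import Relation.Binary.PropositionalEquality
  open import Relation.Nullary using (yes; no; does)
  open import Relation.Unary using (Decidable)
  open import Algebra.Properties.Semiring.Sum +-*-semiring
    using (sum; sum-syntax; sum-cong-≗; sum-replicate-zero; ∑-distrib-+; *-distribˡ-sum)

  private variable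
    X Y : Set
    N : ℕ

  ∑ᴸ : List X → (X → ℤ) → ℤ
  ∑ᴸ xs f = foldr (λ x → f x +_) 0ℤ xs

  ∑ᴸ-cong : (xs : List X) {f g : X → ℤ} → (∀ x → f x ≡ g x) → ∑ᴸ xs f ≡ ∑ᴸ xs g
  ∑ᴸ-cong []       f≗g = refl
  ∑ᴸ-cong (x ∷ xs) f≗g = cong₂ _+_ (f≗g x) (∑ᴸ-cong xs f≗g)

  ∑ᴸ-++ : (xs ys : List X) (f : X → ℤ) → ∑ᴸ (xs ++ ys) f ≡ ∑ᴸ xs f + ∑ᴸ ys f
  ∑ᴸ-++ []       ys f = sym (+-identityˡ _)
  ∑ᴸ-++ (x ∷ xs) ys f = trans (cong (f x +_) (∑ᴸ-++ xs ys f)) (sym (+-assoc (f x) _ _))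

  ∑ᴸ-concatMap : (h : X → List Y) (xs : List X) (f : Y → ℤ) →
                 ∑ᴸ (concatMap h xs) f ≡ ∑ᴸ xs (λ x → ∑ᴸ (h x) f)
  ∑ᴸ-concatMap h []       f = refl
  ∑ᴸ-concatMap h (x ∷ xs) f = trans (∑ᴸ-++ (h x) _ f) (cong (∑ᴸ (h x) f +_) (∑ᴸ-concatMap h xs f))

  ∑ᴸ-map : (h : X → Y) (xs : List X) (f : Y → ℤ) → ∑ᴸ (map h xs) f ≡ ∑ᴸ xs (f ∘ h)
  ∑ᴸ-map h []       f = refl
  ∑ᴸ-map h (x ∷ xs) f = cong (f (h x) +_) (∑ᴸ-map h xs f)

  ∑ᴸ-tabulate : (h : Fin N → X) (f : X → ℤ) → ∑ᴸ (tabulate h) f ≡ sum (f ∘ h)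
  ∑ᴸ-tabulate {zero}  h f = refl
  ∑ᴸ-tabulate {suc N} h f = cong (f (h zero) +_) (∑ᴸ-tabulate (h ∘ suc) f)

  ∑ᴸ-*ˡ : (xs : List X) (c : ℤ) (f : X → ℤ) → ∑ᴸ xs (λ x → c * f x) ≡ c * ∑ᴸ xs f
  ∑ᴸ-*ˡ []       c f = sym (*-zeroʳ c)
  ∑ᴸ-*ˡ (x ∷ xs) c f = trans (cong (c * f x +_) (∑ᴸ-*ˡ xs c f)) (sym (*-distribˡ-+ c (f x) _))

  ∑ᴸ-∑-comm : (xs : List X) (h : X → Fin N → ℤ) →
              ∑ᴸ xs (λ x → ∑[ j < N ] h x j) ≡ ∑[ j < N ] ∑ᴸ xs (λ x → h x j)
  ∑ᴸ-∑-comm {N = N} [] h = sym (sum-replicate-zero N)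
  ∑ᴸ-∑-comm (x ∷ xs) h = trans (cong (sum (h x) +_) (∑ᴸ-∑-comm xs h)) (sym (∑-distrib-+ (h x) _))

  ∑ᴸ-filter : {P : X → Set} (P? : Decidable P) (xs : List X) (f : X → ℤ) →
              ∑ᴸ (filter P? xs) f ≡ ∑ᴸ xs (λ x → if does (P? x) then f x else 0ℤ)
  ∑ᴸ-filter P? []       f = refl
  ∑ᴸ-filter P? (x ∷ xs) f with P? x
  ... | yes _ = cong (f x +_) (∑ᴸ-filter P? xs f)
  ... | no  _ = trans (∑ᴸ-filter P? xs f) (sym (+-identityˡ _))

  Σℤ≡sum : (N : ℕ) (f : Fin N → ℤ) → Σℤ N f ≡ sum f
  Σℤ≡sum zero    f = refl
  Σℤ≡sum (suc N) f = cong (_+_ (f zero)) (Σℤ≡sum N (f ∘ suc))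

  sum-cong-*ˡ : (c : ℤ) {f g : Fin N → ℤ} → (∀ k → f k ≡ c * g k) → sum f ≡ c * sum g
  sum-cong-*ˡ {N} c {g = g} f≗cg = trans (sum-cong-≗ {N} f≗cg) (sym (*-distribˡ-sum c g))

module Signs where

  open import Data.Nat as ℕ using (ℕ; zero; suc)
  open import Data.Integer using (ℤ; +_; -[1+_]; 0ℤ; 1ℤ; -1ℤ; _*_; -_; _^_)
  open import Data.Integer.Properties using (^-zeroˡ; ^-*-assoc)
  open import Data.Integer.Tactic.RingSolver using (solve-∀)
  open import Relation.Binary.PropositionalEquality

  i≡-i⇒i≡0 : {i : ℤ} → i ≡ - i → i ≡ 0ℤ
  i≡-i⇒i≡0 {+ zero}    _  = refl
  i≡-i⇒i≡0 {+ suc _}   ()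
  i≡-i⇒i≡0 { -[1+ _ ]} ()

  -1^[2*n]≡1 : (n : ℕ) → -1ℤ ^ (2 ℕ.* n) ≡ 1ℤ
  -1^[2*n]≡1 n = trans (sym (^-*-assoc -1ℤ 2 n)) (^-zeroˡ n)

  -1^[1+2*n]≡-1 : (n : ℕ) → -1ℤ ^ suc (2 ℕ.* n) ≡ -1ℤ
  -1^[1+2*n]≡-1 n = cong (-1ℤ *_) (-1^[2*n]≡1 n)

  -1^n*-1^n≡1 : (n : ℕ) → -1ℤ ^ n * -1ℤ ^ n ≡ 1ℤ
  -1^n*-1^n≡1 zero    = refl
  -1^n*-1^n≡1 (suc n) = trans (square-neg (-1ℤ ^ n)) (-1^n*-1^n≡1 n)
    where
    square-neg : ∀ p → (-1ℤ * p) * (-1ℤ * p) ≡ p * p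
    square-neg = solve-∀

  sign^≡-1^ : (k : ℕ) → sign^ k ≡ -1ℤ ^ k
  sign^≡-1^ zero          = refl
  sign^≡-1^ (suc zero)    = refl
  sign^≡-1^ (suc (suc k)) = trans (sign^≡-1^ k) (double-negation (-1ℤ ^ k))
    where
    double-negation : ∀ p → p ≡ -1ℤ * (-1ℤ * p)
    double-negation = solve-∀

module Permanent where

  open import Data.Nat using (ℕ; zero; suc)
  open import Data.Integer using (ℤ; 1ℤ; _+_; _*_; _-_)
  open import Data.Integer.Properties using (+-*-semiring; *-comm; *-commutativeSemigroup)
  open import Data.Integer.Tactic.RingSolver using (solve-∀)
  open import Data.Fin using (Fin; zero; suc; punchIn)
  open import Data.Fin.Properties using (punchInᵢ≢i)
  open import Data.Fin.Permutation as Permutation using (Permutation′; _⟨$⟩ʳ_; remove; punchIn-permute)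
  open import Function using (_∘_)
  open import Relation.Binary.PropositionalEquality
  open import Algebra.Properties.Semiring.Sum +-*-semiring
    using (sum-syntax; sum⁺-syntax; sum-cong-≗; sum-remove; sum-permute; ∑-comm; *-distribˡ-sum)
  open import Algebra.Properties.CommutativeSemigroup *-commutativeSemigroup
    using () renaming (x∙yz≈y∙xz to *-exchange)

  private variable
    N : ℕ

  Matrix : ℕ → Set
  Matrix N = Fin N → Fin N → ℤ

  minor : Fin (suc N) → Fin (suc N) → Matrix (suc N) → Matrix N
  minor r c A i j = A (punchIn r i) (punchIn c j)

  per : Matrix N → ℤ
  per {zero}  A = 1ℤ
  per {suc N} A = ∑[ j ≤ N ] (A zero j * per (minor zero j A))

  _ᵀ : Matrix N → Matrix N
  (A ᵀ) i j = A j i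

  per-cong : {A B : Matrix N} → (∀ i j → A i j ≡ B i j) → per A ≡ per B
  per-cong {zero}  A≗B = refl
  per-cong {suc N} A≗B =
    sum-cong-≗ λ j → cong₂ _*_ (A≗B zero j) (per-cong λ a b → A≗B (suc a) (punchIn j b))

  per-expandColumn₀ : (A : Matrix (suc N)) → per A ≡ ∑[ i ≤ N ] (A i zero * per (minor i zero A))
  per-expandColumn₀ {zero}  A = refl
  per-expandColumn₀ {suc N} A = cong (A zero zero * per (minor zero zero A) +_) (begin
    ∑[ j ≤ N ] (A zero (suc j) * per (minor zero (suc j) A))
      ≡⟨ sum-cong-≗ (λ j → cong (A zero (suc j) *_) (per-expandColumn₀ (minor zero (suc j) A))) ⟩
    ∑[ j ≤ N ] (A zero (suc j) * ∑[ i ≤ N ] (A (suc i) zero * per (minor² j i)))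
      ≡⟨ sum-cong-≗ (λ j → *-distribˡ-sum (A zero (suc j)) (λ i → A (suc i) zero * per (minor² j i))) ⟩
    ∑[ j ≤ N ] ∑[ i ≤ N ] (A zero (suc j) * (A (suc i) zero * per (minor² j i)))
      ≡⟨ ∑-comm (λ j i → A zero (suc j) * (A (suc i) zero * per (minor² j i))) ⟩
    ∑[ i ≤ N ] ∑[ j ≤ N ] (A zero (suc j) * (A (suc i) zero * per (minor² j i)))
      ≡⟨ sum-cong-≗ (λ i → sum-cong-≗ λ j → *-exchange (A zero (suc j)) (A (suc i) zero) (per (minor² j i))) ⟩
    ∑[ i ≤ N ] ∑[ j ≤ N ] (A (suc i) zero * (A zero (suc j) * per (minor² j i)))
      ≡⟨ sum-cong-≗ (λ i → *-distribˡ-sum (A (suc i) zero) (λ j → A zero (suc j) * per (minor² j i))) ⟨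
    ∑[ i ≤ N ] (A (suc i) zero * per (minor (suc i) zero A)) ∎)
    where
    open ≡-Reasoning
    minor² : Fin (suc N) → Fin (suc N) → Matrix N
    minor² j i = minor i zero (minor zero (suc j) A)

  per-transpose : (A : Matrix N) → per (A ᵀ) ≡ per A
  per-transpose {zero}  A = refl
  per-transpose {suc N} A =
    trans (sum-cong-≗ λ j → cong (A j zero *_) (per-transpose (minor j zero A))) (sym (per-expandColumn₀ A))

  per-permuteColumns : (π : Permutation′ N) (A : Matrix N) → per (λ i j → A i (π ⟨$⟩ʳ j)) ≡ per A
  per-permuteColumns {zero}  π A = refl
  per-permuteColumns {suc N} π A = begin
    ∑[ j ≤ N ] (A zero (π ⟨$⟩ʳ j) * per (minor zero j (λ i j → A i (π ⟨$⟩ʳ j))))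
      ≡⟨ sum-cong-≗ (λ j → cong (A zero (π ⟨$⟩ʳ j) *_) (minor-permuted j)) ⟩
    ∑[ j ≤ N ] expansionTerm (π ⟨$⟩ʳ j)
      ≡⟨ sum-permute expansionTerm π ⟨
    per A ∎
    where
    open ≡-Reasoning
    expansionTerm : Fin (suc N) → ℤ
    expansionTerm x = A zero x * per (minor zero x A)
    minor-permuted : ∀ j → per (minor zero j (λ i j → A i (π ⟨$⟩ʳ j))) ≡ per (minor zero (π ⟨$⟩ʳ j) A)
    minor-permuted j = trans (per-cong λ a b → cong (A (suc a)) (punchIn-permute π j b))
                             (per-permuteColumns (remove j π) (minor zero (π ⟨$⟩ʳ j) A))

  per-permuteRows : (π : Permutation′ N) (A : Matrix N) → per (λ i j → A (π ⟨$⟩ʳ i) j) ≡ per A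
  per-permuteRows π A = begin
    per (λ i j → A (π ⟨$⟩ʳ i) j)     ≡⟨ per-transpose (λ i j → A (π ⟨$⟩ʳ i) j) ⟨
    per (λ i j → (A ᵀ) i (π ⟨$⟩ʳ j)) ≡⟨ per-permuteColumns π (A ᵀ) ⟩
    per (A ᵀ)                        ≡⟨ per-transpose A ⟩
    per A                            ∎
    where open ≡-Reasoning

  per-expandRow : (r : Fin (suc N)) (A : Matrix (suc N)) → per A ≡ ∑[ j ≤ N ] (A r j * per (minor r j A))
  per-expandRow {N} r A = begin
    per A
      ≡⟨ per-permuteRows π A ⟨
    ∑[ j ≤ N ] (A r j * per (minor zero j (λ i j → A (π ⟨$⟩ʳ i) j)))
      ≡⟨ sum-cong-≗ (λ j → cong (A r j *_) (minor-permuted j)) ⟩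
    ∑[ j ≤ N ] (A r j * per (minor r j A)) ∎
    where
    open ≡-Reasoning
    π : Permutation′ (suc N)
    π = Permutation.transpose zero r
    minor-permuted : ∀ j → per (minor zero j (λ i j → A (π ⟨$⟩ʳ i) j)) ≡ per (minor r j A)
    minor-permuted j = trans (per-cong λ a b → cong (λ i → A i (punchIn j b)) (punchIn-permute π zero a))
                             (per-permuteRows (remove zero π) (minor r j A))

  per-scaleRows : (s : Fin N → ℤ) (A : Matrix N) → per (λ i j → s i * A i j) ≡ Πℤ N s * per A
  per-scaleRows {zero}  s A = refl
  per-scaleRows {suc N} s A = begin
    ∑[ j ≤ N ] ((s zero * A zero j) * per (λ a b → s (suc a) * minor zero j A a b))
      ≡⟨ sum-cong-≗ (λ j → cong ((s zero * A zero j) *_) (per-scaleRows (s ∘ suc) (minor zero j A))) ⟩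
    ∑[ j ≤ N ] ((s zero * A zero j) * (Πℤ N (s ∘ suc) * per (minor zero j A)))
      ≡⟨ sum-cong-≗ (λ j → interchange (s zero) (A zero j) (Πℤ N (s ∘ suc)) (per (minor zero j A))) ⟩
    ∑[ j ≤ N ] (Πℤ (suc N) s * (A zero j * per (minor zero j A)))
      ≡⟨ *-distribˡ-sum (Πℤ (suc N) s) (λ j → A zero j * per (minor zero j A)) ⟨
    Πℤ (suc N) s * per A ∎
    where
    open ≡-Reasoning
    interchange : ∀ a b c d → (a * b) * (c * d) ≡ (a * c) * (b * d)
    interchange = solve-∀

  per-scaleColumns : (s : Fin N → ℤ) (A : Matrix N) → per (λ i j → A i j * s j) ≡ Πℤ N s * per A
  per-scaleColumns {N} s A = begin
    per (λ i j → A i j * s j)     ≡⟨ per-transpose (λ i j → A i j * s j) ⟨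
    per (λ i j → A j i * s i)     ≡⟨ per-cong (λ i j → *-comm (A j i) (s i)) ⟩
    per (λ i j → s i * (A ᵀ) i j) ≡⟨ per-scaleRows s (A ᵀ) ⟩
    Πℤ N s * per (A ᵀ)            ≡⟨ cong (Πℤ N s *_) (per-transpose A) ⟩
    Πℤ N s * per A                ∎
    where open ≡-Reasoning

  per-linear-entry : (r c : Fin (suc N)) (A B : Matrix (suc N)) →
    (∀ i j → i ≢ r → A i j ≡ B i j) → (∀ j → j ≢ c → A r j ≡ B r j) →
    per A ≡ per B + (A r c - B r c) * per (minor r c A)
  per-linear-entry {N} r c A B other-rows row-r = begin
    per A
      ≡⟨ expand A ⟩
    A r c * per (minor r c A) + ∑[ k < N ] (A r (punchIn c k) * per (minor r (punchIn c k) A))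
      ≡⟨ cong₂ (λ x y → A r c * x + y) (minors c) (sum-cong-≗ λ k → cong₂ _*_ (row-r _ (punchInᵢ≢i c k))
                                                                             (minors (punchIn c k))) ⟩
    A r c * per (minor r c B) + ∑[ k < N ] (B r (punchIn c k) * per (minor r (punchIn c k) B))
      ≡⟨ rearrange (A r c) (B r c) (per (minor r c B)) _ ⟩
    (B r c * per (minor r c B) + ∑[ k < N ] (B r (punchIn c k) * per (minor r (punchIn c k) B)))
      + (A r c - B r c) * per (minor r c B)
      ≡⟨ cong₂ _+_ (sym (expand B)) (cong ((A r c - B r c) *_) (sym (minors c))) ⟩
    per B + (A r c - B r c) * per (minor r c A) ∎
    where
    open ≡-Reasoning
    expand : ∀ X → per X ≡ X r c * per (minor r c X)
                             + ∑[ k < N ] (X r (punchIn c k) * per (minor r (punchIn c k) X))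
    expand X = trans (per-expandRow r X) (sum-remove {i = c} (λ j → X r j * per (minor r j X)))
    minors : ∀ j → per (minor r j A) ≡ per (minor r j B)
    minors j = per-cong λ a b → other-rows (punchIn r a) (punchIn j b) (punchInᵢ≢i r a)
    rearrange : ∀ a b m s → a * m + s ≡ (b * m + s) + (a - b) * m
    rearrange = solve-∀

module LaplaceExpansion where

  open Sums
  open Permanent using (Matrix; minor; per)
  open import Data.Nat using (ℕ; zero; suc)
  open import Data.Integer using (ℤ; 0ℤ; 1ℤ; _+_; _*_)
  open import Data.Integer.Properties
    using (+-*-semiring; +-identityˡ; *-identityˡ; *-zeroˡ; *-zeroʳ; *-assoc; *-commutativeSemigroup)
  open import Data.Integer.Tactic.RingSolver using (solve-∀)
  open import Data.Fin using (Fin; zero; suc; punchIn)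
  open import Data.Fin.Properties using (punchIn-injective; punchInᵢ≢i; suc-injective; any?) renaming (_≟_ to _≟F_)
  open import Data.List using (allFin)
  open import Data.Vec.Functional using (_∷_)
  open import Data.Product using (_,_)
  open import Data.Bool using (if_then_else_)
  open import Function using (_∘_; id)
  open import Function.Definitions using (Injective)
  open import Relation.Binary.PropositionalEquality
  open import Relation.Nullary using (¬_; Dec; yes; no; does; contradiction)
  open import Algebra.Properties.Semiring.Sum +-*-semiring
    using (sum-syntax; sum⁺-syntax; sum-cong-≗; sum-remove)
  open import Algebra.Properties.CommutativeSemigroup *-commutativeSemigroup
    using () renaming (x∙yz≈y∙xz to *-exchange)

  private variable
    N M : ℕ

  𝟙≢ : Fin M → Fin M → ℤ
  𝟙≢ x y = if does (x ≟F y) then 0ℤ else 1ℤ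

  𝟙∉ : Fin M → (Fin N → Fin M) → ℤ
  𝟙∉ {N = zero}  x f = 1ℤ
  𝟙∉ {N = suc N} x f = 𝟙≢ x (f zero) * 𝟙∉ x (f ∘ suc)

  𝟙injective : (Fin N → Fin M) → ℤ
  𝟙injective {zero}  f = 1ℤ
  𝟙injective {suc N} f = 𝟙∉ (f zero) (f ∘ suc) * 𝟙injective (f ∘ suc)

  𝟙≢-≡ : {x y : Fin M} → x ≡ y → 𝟙≢ x y ≡ 0ℤ
  𝟙≢-≡ {x = x} refl with x ≟F x
  ... | yes _  = refl
  ... | no x≢x = contradiction refl x≢x

  𝟙≢-≢ : {x y : Fin M} → x ≢ y → 𝟙≢ x y ≡ 1ℤ
  𝟙≢-≢ {x = x} {y} x≢y with x ≟F y
  ... | yes x≡y = contradiction x≡y x≢y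
  ... | no  _   = refl

  𝟙≢-punchIn : (x : Fin (suc M)) (k l : Fin M) → 𝟙≢ (punchIn x k) (punchIn x l) ≡ 𝟙≢ k l
  𝟙≢-punchIn x k l with k ≟F l
  ... | yes k≡l = 𝟙≢-≡ (cong (punchIn x) k≡l)
  ... | no  k≢l = 𝟙≢-≢ (k≢l ∘ punchIn-injective x k l)

  𝟙∉-cong : (x : Fin M) {f g : Fin N → Fin M} → (∀ i → f i ≡ g i) → 𝟙∉ x f ≡ 𝟙∉ x g
  𝟙∉-cong {N = zero}  x f≗g = refl
  𝟙∉-cong {N = suc N} x f≗g = cong₂ _*_ (cong (𝟙≢ x) (f≗g zero)) (𝟙∉-cong x (f≗g ∘ suc))

  𝟙∉-punchIn : (x : Fin (suc M)) (k : Fin M) (g : Fin N → Fin M) →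
               𝟙∉ (punchIn x k) (punchIn x ∘ g) ≡ 𝟙∉ k g
  𝟙∉-punchIn {N = zero}  x k g = refl
  𝟙∉-punchIn {N = suc N} x k g = cong₂ _*_ (𝟙≢-punchIn x k (g zero)) (𝟙∉-punchIn x k (g ∘ suc))

  𝟙∉-avoided : (x : Fin M) (f : Fin N → Fin M) → (∀ i → f i ≢ x) → 𝟙∉ x f ≡ 1ℤ
  𝟙∉-avoided {N = zero}  x f avoid = refl
  𝟙∉-avoided {N = suc N} x f avoid =
    cong₂ _*_ (𝟙≢-≢ (avoid zero ∘ sym)) (𝟙∉-avoided x (f ∘ suc) (avoid ∘ suc))

  𝟙∉-hit : (x : Fin M) (f : Fin N → Fin M) (i : Fin N) → f i ≡ x → 𝟙∉ x f ≡ 0ℤ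
  𝟙∉-hit x f zero    fi≡x =
    trans (cong (_* 𝟙∉ x (f ∘ suc)) (𝟙≢-≡ (sym fi≡x))) (*-zeroˡ (𝟙∉ x (f ∘ suc)))
  𝟙∉-hit x f (suc i) fi≡x =
    trans (cong (𝟙≢ x (f zero) *_) (𝟙∉-hit x (f ∘ suc) i fi≡x)) (*-zeroʳ (𝟙≢ x (f zero)))

  𝟙injective-injective : (f : Fin N → Fin M) → Injective _≡_ _≡_ f → 𝟙injective f ≡ 1ℤ
  𝟙injective-injective {zero}  f inj = refl
  𝟙injective-injective {suc N} f inj =
    cong₂ _*_ (𝟙∉-avoided (f zero) (f ∘ suc) (λ i → suc≢zero ∘ inj))
              (𝟙injective-injective (f ∘ suc) (suc-injective ∘ inj))
    where
    suc≢zero : {i : Fin N} → suc i ≢ zero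
    suc≢zero ()

  𝟙injective-¬injective : (f : Fin N → Fin M) → ¬ Injective _≡_ _≡_ f → 𝟙injective f ≡ 0ℤ
  𝟙injective-¬injective {zero}  f ¬inj = contradiction (λ { {()} }) ¬inj
  𝟙injective-¬injective {suc N} f ¬inj with any? (λ i → f (suc i) ≟F f zero)
  ... | yes (i , hit) =
    trans (cong (_* 𝟙injective (f ∘ suc)) (𝟙∉-hit (f zero) (f ∘ suc) i hit))
          (*-zeroˡ (𝟙injective (f ∘ suc)))
  ... | no ¬hit =
    cong₂ _*_ (𝟙∉-avoided (f zero) (f ∘ suc) (λ i hit → ¬hit (i , hit)))
              (𝟙injective-¬injective (f ∘ suc) ¬inj-tail)
    where
    ¬inj-tail : ¬ Injective _≡_ _≡_ (f ∘ suc)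
    ¬inj-tail inj-tail = ¬inj λ {i} {j} → injective i j
      where
      injective : ∀ i j → f i ≡ f j → i ≡ j
      injective zero    zero    _  = refl
      injective zero    (suc j) eq = contradiction (j , sym eq) ¬hit
      injective (suc i) zero    eq = contradiction (i , eq) ¬hit
      injective (suc i) (suc j) eq = cong suc (inj-tail eq)

  ∑ᴸ-allFuns-suc : (w : (Fin (suc N) → Fin M) → ℤ) →
                   ∑ᴸ (allFuns (suc N) M) w ≡ ∑ᴸ (allFuns N M) (λ f → ∑[ x < M ] w (x ∷ f))
  ∑ᴸ-allFuns-suc {N} {M} w = trans (∑ᴸ-concatMap _ (allFuns N M) w) (∑ᴸ-cong (allFuns N M) λ f →
    trans (∑ᴸ-map (_∷ f) (allFin M) w) (∑ᴸ-tabulate id (λ x → w (x ∷ f))))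

  Extensional : ((Fin N → Fin M) → ℤ) → Set
  Extensional w = ∀ {f g} → (∀ i → f i ≡ g i) → w f ≡ w g

  ∑-head-avoiding : (x : Fin (suc M)) (w : (Fin (suc N) → Fin (suc M)) → ℤ) (f : Fin N → Fin (suc M)) →
    ∑[ y ≤ M ] (𝟙∉ x (y ∷ f) * (𝟙injective (y ∷ f) * w (y ∷ f)))
      ≡ ∑[ k < M ] (𝟙∉ x f * (𝟙injective f * (𝟙∉ (punchIn x k) f * w (punchIn x k ∷ f))))
  ∑-head-avoiding {M} x w f = begin
    ∑[ y ≤ M ] term y                                 ≡⟨ sum-remove {i = x} term ⟩
    term x + ∑[ k < M ] term (punchIn x k)            ≡⟨ cong₂ _+_ term-x≡0 (sum-cong-≗ term-punchIn) ⟩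
    0ℤ + ∑[ k < M ] term′ k                           ≡⟨ +-identityˡ _ ⟩
    ∑[ k < M ] term′ k                                ∎
    where
    open ≡-Reasoning
    term : Fin (suc M) → ℤ
    term y = 𝟙∉ x (y ∷ f) * (𝟙injective (y ∷ f) * w (y ∷ f))
    term′ : Fin M → ℤ
    term′ k = 𝟙∉ x f * (𝟙injective f * (𝟙∉ (punchIn x k) f * w (punchIn x k ∷ f)))
    term-x≡0 : term x ≡ 0ℤ
    term-x≡0 = begin
      (𝟙≢ x x * 𝟙∉ x f) * R  ≡⟨ cong (λ z → (z * 𝟙∉ x f) * R) (𝟙≢-≡ {x = x} refl) ⟩
      (0ℤ * 𝟙∉ x f) * R      ≡⟨ cong (_* R) (*-zeroˡ (𝟙∉ x f)) ⟩
      0ℤ * R                 ≡⟨ *-zeroˡ R ⟩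
      0ℤ                     ∎
      where
      R : ℤ
      R = 𝟙injective (x ∷ f) * w (x ∷ f)
    rearrange : ∀ a b c d → (1ℤ * a) * ((b * c) * d) ≡ a * (c * (b * d))
    rearrange = solve-∀
    term-punchIn : ∀ k → term (punchIn x k) ≡ term′ k
    term-punchIn k = begin
      (𝟙≢ x y * 𝟙∉ x f) * ((𝟙∉ y f * 𝟙injective f) * w (y ∷ f))
        ≡⟨ cong (λ z → (z * 𝟙∉ x f) * ((𝟙∉ y f * 𝟙injective f) * w (y ∷ f))) (𝟙≢-≢ (punchInᵢ≢i x k ∘ sym)) ⟩
      (1ℤ * 𝟙∉ x f) * ((𝟙∉ y f * 𝟙injective f) * w (y ∷ f))
        ≡⟨ rearrange (𝟙∉ x f) (𝟙∉ y f) (𝟙injective f) (w (y ∷ f)) ⟩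
      𝟙∉ x f * (𝟙injective f * (𝟙∉ y f * w (y ∷ f))) ∎
      where
      y : Fin (suc M)
      y = punchIn x k

  -- The injective maps avoiding x are exactly the maps punchIn x ∘ g with g injective.
  ∑ᴸ-avoiding-injective : (x : Fin (suc M)) (w : (Fin N → Fin (suc M)) → ℤ) → Extensional w →
    ∑ᴸ (allFuns N (suc M)) (λ f → 𝟙∉ x f * (𝟙injective f * w f))
      ≡ ∑ᴸ (allFuns N M) (λ g → 𝟙injective g * w (punchIn x ∘ g))
  ∑ᴸ-avoiding-injective {N = zero}  x w ext =
    cong (_+ 0ℤ) (trans (*-identityˡ _) (cong (1ℤ *_) (ext λ ())))
  ∑ᴸ-avoiding-injective {M} {suc N} x w ext = begin
    ∑ᴸ (allFuns (suc N) (suc M)) (λ f → 𝟙∉ x f * (𝟙injective f * w f))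
      ≡⟨ ∑ᴸ-allFuns-suc (λ f → 𝟙∉ x f * (𝟙injective f * w f)) ⟩
    ∑ᴸ (allFuns N (suc M)) (λ f → ∑[ y ≤ M ] (𝟙∉ x (y ∷ f) * (𝟙injective (y ∷ f) * w (y ∷ f))))
      ≡⟨ ∑ᴸ-cong (allFuns N (suc M)) (∑-head-avoiding x w) ⟩
    ∑ᴸ (allFuns N (suc M)) (λ f → ∑[ k < M ] (𝟙∉ x f * (𝟙injective f * W k f)))
      ≡⟨ ∑ᴸ-∑-comm (allFuns N (suc M)) (λ f k → 𝟙∉ x f * (𝟙injective f * W k f)) ⟩
    ∑[ k < M ] ∑ᴸ (allFuns N (suc M)) (λ f → 𝟙∉ x f * (𝟙injective f * W k f))
      ≡⟨ sum-cong-≗ (λ k → ∑ᴸ-avoiding-injective x (W k) (W-ext k)) ⟩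
    ∑[ k < M ] ∑ᴸ (allFuns N M) (λ g → 𝟙injective g * W k (punchIn x ∘ g))
      ≡⟨ sum-cong-≗ (λ k → ∑ᴸ-cong (allFuns N M) (W-punchIn k)) ⟩
    ∑[ k < M ] ∑ᴸ (allFuns N M) (λ g → w′ (k ∷ g))
      ≡⟨ ∑ᴸ-∑-comm (allFuns N M) (λ g k → w′ (k ∷ g)) ⟨
    ∑ᴸ (allFuns N M) (λ g → ∑[ k < M ] w′ (k ∷ g))
      ≡⟨ ∑ᴸ-allFuns-suc w′ ⟨
    ∑ᴸ (allFuns (suc N) M) w′ ∎
    where
    open ≡-Reasoning
    w′ : (Fin (suc N) → Fin M) → ℤ
    w′ g = 𝟙injective g * w (punchIn x ∘ g)
    W : Fin M → (Fin N → Fin (suc M)) → ℤ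
    W k f = 𝟙∉ (punchIn x k) f * w (punchIn x k ∷ f)
    W-ext : ∀ k → Extensional (W k)
    W-ext k f≗g = cong₂ _*_ (𝟙∉-cong _ f≗g) (ext λ { zero → refl ; (suc i) → f≗g i })
    W-punchIn : ∀ k g → 𝟙injective g * W k (punchIn x ∘ g) ≡ w′ (k ∷ g)
    W-punchIn k g = begin
      𝟙injective g * (𝟙∉ (punchIn x k) (punchIn x ∘ g) * w (punchIn x k ∷ (punchIn x ∘ g)))
        ≡⟨ cong₂ (λ a b → 𝟙injective g * (a * b)) (𝟙∉-punchIn x k g) (ext λ { zero → refl ; (suc i) → refl }) ⟩
      𝟙injective g * (𝟙∉ k g * w (punchIn x ∘ (k ∷ g)))
        ≡⟨ *-exchange (𝟙injective g) (𝟙∉ k g) _ ⟩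
      𝟙∉ k g * (𝟙injective g * w (punchIn x ∘ (k ∷ g)))
        ≡⟨ *-assoc (𝟙∉ k g) (𝟙injective g) _ ⟨
      (𝟙∉ k g * 𝟙injective g) * w (punchIn x ∘ (k ∷ g)) ∎

  Πℤ-cong : {f g : Fin N → ℤ} → (∀ i → f i ≡ g i) → Πℤ N f ≡ Πℤ N g
  Πℤ-cong {zero}  f≗g = refl
  Πℤ-cong {suc N} f≗g = cong₂ _*_ (f≗g zero) (Πℤ-cong (f≗g ∘ suc))

  ∑ᴸ-injective≡per : (A : Matrix N) → ∑ᴸ (allFuns N N) (λ π → 𝟙injective π * Πℤ N (λ i → A i (π i))) ≡ per A
  ∑ᴸ-injective≡per {zero}  A = refl
  ∑ᴸ-injective≡per {suc N} A = begin
    ∑ᴸ (allFuns (suc N) (suc N)) (λ π → 𝟙injective π * Πℤ (suc N) (λ i → A i (π i)))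
      ≡⟨ ∑ᴸ-allFuns-suc (λ π → 𝟙injective π * Πℤ (suc N) (λ i → A i (π i))) ⟩
    ∑ᴸ (allFuns N (suc N)) (λ f → ∑[ x ≤ N ] ((𝟙∉ x f * 𝟙injective f) * (A zero x * Π′ f)))
      ≡⟨ ∑ᴸ-cong (allFuns N (suc N)) (λ f → sum-cong-≗ λ x → rearrange (𝟙∉ x f) (𝟙injective f) (A zero x) (Π′ f)) ⟩
    ∑ᴸ (allFuns N (suc N)) (λ f → ∑[ x ≤ N ] (A zero x * avoiding x f))
      ≡⟨ ∑ᴸ-∑-comm (allFuns N (suc N)) (λ f x → A zero x * avoiding x f) ⟩
    ∑[ x ≤ N ] ∑ᴸ (allFuns N (suc N)) (λ f → A zero x * avoiding x f)
      ≡⟨ sum-cong-≗ (λ x → ∑ᴸ-*ˡ (allFuns N (suc N)) (A zero x) (avoiding x)) ⟩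
    ∑[ x ≤ N ] (A zero x * ∑ᴸ (allFuns N (suc N)) (avoiding x))
      ≡⟨ sum-cong-≗ (λ x → cong (A zero x *_) (∑ᴸ-avoiding-injective x Π′ (λ f≗g → Πℤ-cong (cong (A _) ∘ f≗g)))) ⟩
    ∑[ x ≤ N ] (A zero x * ∑ᴸ (allFuns N N) (λ g → 𝟙injective g * Πℤ N (λ i → minor zero x A i (g i))))
      ≡⟨ sum-cong-≗ (λ x → cong (A zero x *_) (∑ᴸ-injective≡per (minor zero x A))) ⟩
    per A ∎
    where
    open ≡-Reasoning
    Π′ : (Fin N → Fin (suc N)) → ℤ
    Π′ f = Πℤ N (λ i → A (suc i) (f i))
    avoiding : Fin (suc N) → (Fin N → Fin (suc N)) → ℤ
    avoiding x f = 𝟙∉ x f * (𝟙injective f * Π′ f)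
    rearrange : ∀ a b c d → (a * b) * (c * d) ≡ c * (a * (b * d))
    rearrange = solve-∀

  perℤ≡per : (A : Matrix N) → perℤ A ≡ per A
  perℤ≡per {N} A = begin
    ∑ᴸ (perms N) Π[A]
      ≡⟨ ∑ᴸ-filter isInjective? (allFuns N N) Π[A] ⟩
    ∑ᴸ (allFuns N N) (λ π → if does (isInjective? π) then Π[A] π else 0ℤ)
      ≡⟨ ∑ᴸ-cong (allFuns N N) indicator ⟩
    ∑ᴸ (allFuns N N) (λ π → 𝟙injective π * Π[A] π)
      ≡⟨ ∑ᴸ-injective≡per A ⟩
    per A ∎
    where
    open ≡-Reasoning
    Π[A] : (Fin N → Fin N) → ℤ
    Π[A] π = Πℤ N (λ i → A i (π i))
    select : ∀ π (d : Dec (IsInjective π)) → (if does d then Π[A] π else 0ℤ) ≡ 𝟙injective π * Π[A] π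
    select π (yes inj) = sym (trans (cong (_* Π[A] π) (𝟙injective-injective π (inj _ _))) (*-identityˡ _))
    select π (no ¬inj) = sym (cong (_* Π[A] π) (𝟙injective-¬injective π λ inj → ¬inj λ i j → inj))
    indicator : ∀ π → (if does (isInjective? π) then Π[A] π else 0ℤ) ≡ 𝟙injective π * Π[A] π
    indicator π = select π (isInjective? π)

module BinomialSums where

  open import Data.Nat as ℕ using (ℕ; zero; suc; _≤_; _<_; s≤s⁻¹)
  open import Data.Nat.Properties using (*-suc; n<1+n; m≤n*m; m≤n⇒m<n∨m≡n)
  open import Data.Nat.Combinatorics using (_C_; nCn≡1; nCk+nC[k+1]≡[n+1]C[k+1]; k>n⇒nCk≡0)
  open import Data.Integer using (ℤ; +_; 0ℤ; _+_; _*_)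
  open import Data.Integer.Properties
    using (+-*-semiring; +-0-abelianGroup; +-identityʳ; +-comm; *-identityˡ; *-zeroˡ; *-distribʳ-+; pos-+;
           +-commutativeSemigroup; *-commutativeSemigroup)
  open import Data.Fin using (Fin; toℕ)
  open import Data.Fin.Properties using (toℕ<n; toℕ-inject₁; toℕ-fromℕ)
  open import Data.Sum using (inj₁; inj₂)
  open import Function using (_∘_)
  open import Relation.Binary.PropositionalEquality
  open import Algebra.Properties.Semiring.Sum +-*-semiring
    using (sum-syntax; sum⁺-syntax; sum-cong-≗; ∑-distrib-+; *-distribˡ-sum; sum-init-last)
  open import Algebra.Properties.AbelianGroup +-0-abelianGroup using () renaming (∙-cancelˡ to +-cancelˡ)
  open import Algebra.Properties.CommutativeSemigroup +-commutativeSemigroup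
    using () renaming (x∙yz≈y∙xz to +-exchange)
  open import Algebra.Properties.CommutativeSemigroup *-commutativeSemigroup
    using () renaming (x∙yz≈y∙xz to *-exchange)

  binomialSum : ℕ → (ℕ → ℤ) → ℤ
  binomialSum n x = ∑[ k ≤ n ] (+ (n C toℕ k) * x (toℕ k))

  binomialSum-cong : (n : ℕ) {x y : ℕ → ℤ} → (∀ k → k ≤ n → x k ≡ y k) → binomialSum n x ≡ binomialSum n y
  binomialSum-cong n x≗y =
    sum-cong-≗ {suc n} λ k → cong (+ (n C toℕ k) *_) (x≗y (toℕ k) (s≤s⁻¹ (toℕ<n k)))

  binomialSum-zero : (x : ℕ → ℤ) → binomialSum 0 x ≡ x 0
  binomialSum-zero x = trans (+-identityʳ (+ 1 * x 0)) (*-identityˡ (x 0))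

  binomialSum-*ˡ : (n : ℕ) (c : ℤ) (x : ℕ → ℤ) → binomialSum n (λ k → c * x k) ≡ c * binomialSum n x
  binomialSum-*ˡ n c x = trans (sum-cong-≗ {suc n} λ k → *-exchange (+ (n C toℕ k)) c (x (toℕ k)))
                               (sym (*-distribˡ-sum {suc n} c (λ k → + (n C toℕ k) * x (toℕ k))))

  ∑-toℕ-init-last : (n : ℕ) (f : ℕ → ℤ) → ∑[ k ≤ n ] f (toℕ k) ≡ ∑[ k < n ] f (toℕ k) + f n
  ∑-toℕ-init-last n f = trans (sum-init-last {n} (f ∘ toℕ))
                              (cong₂ _+_ (sum-cong-≗ {n} (cong f ∘ toℕ-inject₁)) (cong f (toℕ-fromℕ n)))

  binomialSum-init-last : (n : ℕ) (x : ℕ → ℤ) →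
                          binomialSum n x ≡ ∑[ k < n ] (+ (n C toℕ k) * x (toℕ k)) + x n
  binomialSum-init-last n x = trans (∑-toℕ-init-last n (λ k → + (n C k) * x k)) (cong (_+_ lower) top)
    where
    lower : ℤ
    lower = ∑[ k < n ] (+ (n C toℕ k) * x (toℕ k))
    top : + (n C n) * x n ≡ x n
    top = trans (cong (λ c → + c * x n) (nCn≡1 n)) (*-identityˡ (x n))

  binomialSum-suc : (n : ℕ) (x : ℕ → ℤ) → binomialSum (suc n) x ≡ binomialSum n x + binomialSum n (x ∘ suc)
  binomialSum-suc n x = begin
    + 1 * x 0 + ∑[ k ≤ n ] (+ (suc n C suc (toℕ k)) * x (suc (toℕ k)))
      ≡⟨ cong (_+_ (+ 1 * x 0)) (trans (sum-cong-≗ {suc n} pascal) (∑-distrib-+ {suc n} shifted lowered)) ⟩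
    + 1 * x 0 + (binomialSum n (x ∘ suc) + ∑[ k ≤ n ] lowered k)
      ≡⟨ +-exchange (+ 1 * x 0) (binomialSum n (x ∘ suc)) _ ⟩
    binomialSum n (x ∘ suc) + ∑[ k ≤ suc n ] (+ (n C toℕ k) * x (toℕ k))
      ≡⟨ cong (_+_ (binomialSum n (x ∘ suc))) (∑-toℕ-init-last (suc n) (λ k → + (n C k) * x k)) ⟩
    binomialSum n (x ∘ suc) + (binomialSum n x + + (n C suc n) * x (suc n))
      ≡⟨ cong (λ c → binomialSum n (x ∘ suc) + (binomialSum n x + + c * x (suc n))) (k>n⇒nCk≡0 (n<1+n n)) ⟩
    binomialSum n (x ∘ suc) + (binomialSum n x + 0ℤ * x (suc n))
      ≡⟨ cong (λ c → binomialSum n (x ∘ suc) + (binomialSum n x + c)) (*-zeroˡ (x (suc n))) ⟩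
    binomialSum n (x ∘ suc) + (binomialSum n x + 0ℤ)
      ≡⟨ cong (_+_ (binomialSum n (x ∘ suc))) (+-identityʳ (binomialSum n x)) ⟩
    binomialSum n (x ∘ suc) + binomialSum n x
      ≡⟨ +-comm (binomialSum n (x ∘ suc)) (binomialSum n x) ⟩
    binomialSum n x + binomialSum n (x ∘ suc) ∎
    where
    open ≡-Reasoning
    shifted lowered : Fin (suc n) → ℤ
    shifted k = + (n C toℕ k) * x (suc (toℕ k))
    lowered k = + (n C suc (toℕ k)) * x (suc (toℕ k))
    pascal : ∀ k → + (suc n C suc (toℕ k)) * x (suc (toℕ k)) ≡ shifted k + lowered k
    pascal k = begin
      + (suc n C suc (toℕ k)) * x (suc (toℕ k))
        ≡⟨ cong (λ c → + c * x (suc (toℕ k))) (nCk+nC[k+1]≡[n+1]C[k+1] n (toℕ k)) ⟨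
      + (n C toℕ k ℕ.+ n C suc (toℕ k)) * x (suc (toℕ k))
        ≡⟨ cong (_* x (suc (toℕ k))) (pos-+ (n C toℕ k) (n C suc (toℕ k))) ⟩
      (+ (n C toℕ k) + + (n C suc (toℕ k))) * x (suc (toℕ k))
        ≡⟨ *-distribʳ-+ (x (suc (toℕ k))) (+ (n C toℕ k)) (+ (n C suc (toℕ k))) ⟩
      shifted k + lowered k ∎

  binomialSum-even-injective : {x y : ℕ → ℤ} →
    (∀ a → x (suc (2 ℕ.* a)) ≡ y (suc (2 ℕ.* a))) →
    (∀ n → binomialSum (2 ℕ.* n) x ≡ binomialSum (2 ℕ.* n) y) →
    ∀ k → x k ≡ y k
  binomialSum-even-injective {x} {y} odd even k = below (suc k) k (m≤n*m (suc k) 2)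
    where
    lower : ℕ → (ℕ → ℤ) → ℤ
    lower n z = ∑[ k < 2 ℕ.* n ] (+ (2 ℕ.* n C toℕ k) * z (toℕ k))
    top : ∀ n → (∀ k → k < 2 ℕ.* n → x k ≡ y k) → x (2 ℕ.* n) ≡ y (2 ℕ.* n)
    top n agree = +-cancelˡ (lower n y) (x (2 ℕ.* n)) (y (2 ℕ.* n)) (begin
      lower n y + x (2 ℕ.* n)   ≡⟨ cong (_+ x (2 ℕ.* n)) lower-agree ⟨
      lower n x + x (2 ℕ.* n)   ≡⟨ binomialSum-init-last (2 ℕ.* n) x ⟨
      binomialSum (2 ℕ.* n) x   ≡⟨ even n ⟩
      binomialSum (2 ℕ.* n) y   ≡⟨ binomialSum-init-last (2 ℕ.* n) y ⟩
      lower n y + y (2 ℕ.* n)   ∎)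
      where
      open ≡-Reasoning
      lower-agree : lower n x ≡ lower n y
      lower-agree = sum-cong-≗ {2 ℕ.* n} λ k → cong (+ (2 ℕ.* n C toℕ k) *_) (agree (toℕ k) (toℕ<n k))
    below : ∀ n k → k < 2 ℕ.* n → x k ≡ y k
    below zero    k ()
    below (suc n) k k<2n+2 with m≤n⇒m<n∨m≡n (s≤s⁻¹ (subst (suc k ≤_) (*-suc 2 n) k<2n+2))
    ... | inj₂ refl = odd n
    ... | inj₁ k<2n+1 with m≤n⇒m<n∨m≡n (s≤s⁻¹ k<2n+1)
    ...   | inj₁ k<2n = below n k k<2n
    ...   | inj₂ refl = top n (below n)

module SignMatrix where

  open Permanent
  open LaplaceExpansion using (perℤ≡per)
  open Signs
  open import Data.Nat as ℕ using (ℕ; zero; suc)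
  open import Data.Nat.Properties using (+-comm; +-suc; m+[n∸m]≡n)
  open import Data.Integer using (ℤ; +_; 0ℤ; 1ℤ; -1ℤ; _*_; -_; _-_; _⊖_; _^_)
  open import Data.Integer.Properties using ([+m]-[+n]≡m⊖n; [1+m]⊖[1+n]≡m⊖n; -1*i≡-i)
  open import Data.Fin using (Fin; toℕ; opposite)
  open import Data.Fin.Properties using (toℕ<n; opposite-prop)
  open import Data.Fin.Permutation using (reverse)
  open import Relation.Binary.PropositionalEquality

  sgnDiff : ℕ → ℕ → ℤ
  sgnDiff zero    zero    = 0ℤ
  sgnDiff zero    (suc b) = -1ℤ
  sgnDiff (suc a) zero    = 1ℤ
  sgnDiff (suc a) (suc b) = sgnDiff a b

  sgn-⊖ : ∀ a b → sgn (a ⊖ b) ≡ sgnDiff a b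
  sgn-⊖ zero    zero    = refl
  sgn-⊖ zero    (suc b) = refl
  sgn-⊖ (suc a) zero    = refl
  sgn-⊖ (suc a) (suc b) = trans (cong sgn ([1+m]⊖[1+n]≡m⊖n a b)) (sgn-⊖ a b)

  sgnDiff-+ˡ : ∀ c a b → sgnDiff (c ℕ.+ a) (c ℕ.+ b) ≡ sgnDiff a b
  sgnDiff-+ˡ zero    a b = refl
  sgnDiff-+ˡ (suc c) a b = sgnDiff-+ˡ c a b

  sgnDiff-swap : ∀ a b → sgnDiff b a ≡ - sgnDiff a b
  sgnDiff-swap zero    zero    = refl
  sgnDiff-swap zero    (suc b) = refl
  sgnDiff-swap (suc a) zero    = refl
  sgnDiff-swap (suc a) (suc b) = sgnDiff-swap a b

  S : (N : ℕ) → Matrix N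
  S N i j = sgnDiff (toℕ j) (toℕ i)

  perS : ℕ → ℤ
  perS N = per (S N)

  P≡S-reversed : (m : ℕ) (i j : Fin m) → P m i j ≡ S m i (opposite j)
  P≡S-reversed m i j = begin
    sgn (+ suc m - + (suc (toℕ i) ℕ.+ suc (toℕ j)))
      ≡⟨ cong sgn ([+m]-[+n]≡m⊖n (suc m) (suc (toℕ i) ℕ.+ suc (toℕ j))) ⟩
    sgn (suc m ⊖ (suc (toℕ i) ℕ.+ suc (toℕ j)))
      ≡⟨ sgn-⊖ (suc m) (suc (toℕ i) ℕ.+ suc (toℕ j)) ⟩
    sgnDiff (suc m) (suc (toℕ i) ℕ.+ suc (toℕ j))
      ≡⟨ cong₂ sgnDiff m≡j+d (+-comm (suc (toℕ i)) (suc (toℕ j))) ⟩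
    sgnDiff (suc (toℕ j) ℕ.+ suc d) (suc (toℕ j) ℕ.+ suc (toℕ i))
      ≡⟨ sgnDiff-+ˡ (suc (toℕ j)) (suc d) (suc (toℕ i)) ⟩
    sgnDiff d (toℕ i)
      ≡⟨ cong (λ e → sgnDiff e (toℕ i)) (opposite-prop j) ⟨
    S m i (opposite j) ∎
    where
    open ≡-Reasoning
    d : ℕ
    d = m ℕ.∸ suc (toℕ j)
    m≡j+d : suc m ≡ suc (toℕ j) ℕ.+ suc d
    m≡j+d = trans (cong suc (sym (m+[n∸m]≡n (toℕ<n j)))) (sym (+-suc (suc (toℕ j)) d))

  P-symmetric : (m : ℕ) (i j : Fin m) → P m i j ≡ P m j i
  P-symmetric m i j = cong (λ s → sgn (+ suc m - + s)) (+-comm (suc (toℕ i)) (suc (toℕ j)))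

  P≡sgnDiff : (m : ℕ) (i k : Fin m) → P m i k ≡ sgnDiff (toℕ (opposite i)) (toℕ k)
  P≡sgnDiff m i k = trans (P-symmetric m i k) (P≡S-reversed m k i)

  perℤ-P≡perS : (m : ℕ) → perℤ (P m) ≡ perS m
  perℤ-P≡perS m = begin
    perℤ (P m)                        ≡⟨ perℤ≡per (P m) ⟩
    per (P m)                         ≡⟨ per-cong (P≡S-reversed m) ⟩
    per (λ i j → S m i (opposite j))  ≡⟨ per-permuteColumns reverse (S m) ⟩
    perS m                            ∎
    where open ≡-Reasoning

  Πℤ-const : (N : ℕ) (x : ℤ) → Πℤ N (λ _ → x) ≡ x ^ N
  Πℤ-const zero    x = refl
  Πℤ-const (suc N) x = cong (x *_) (Πℤ-const N x)

  perS-parity : (N : ℕ) → -1ℤ ^ N * perS N ≡ perS N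
  perS-parity N = sym (begin
    per (S N)                    ≡⟨ per-transpose (S N) ⟨
    per ((S N) ᵀ)                ≡⟨ per-cong skew ⟩
    per (λ i j → -1ℤ * S N i j)  ≡⟨ per-scaleRows (λ _ → -1ℤ) (S N) ⟩
    Πℤ N (λ _ → -1ℤ) * perS N    ≡⟨ cong (_* perS N) (Πℤ-const N -1ℤ) ⟩
    -1ℤ ^ N * perS N             ∎)
    where
    open ≡-Reasoning
    skew : ∀ i j → S N j i ≡ -1ℤ * S N i j
    skew i j = trans (sgnDiff-swap (toℕ j) (toℕ i)) (sym (-1*i≡-i (S N i j)))

  perS-odd : (n : ℕ) → perS (suc (2 ℕ.* n)) ≡ 0ℤ
  perS-odd n = i≡-i⇒i≡0 (begin
    perS (suc (2 ℕ.* n))                         ≡⟨ perS-parity (suc (2 ℕ.* n)) ⟨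
    -1ℤ ^ suc (2 ℕ.* n) * perS (suc (2 ℕ.* n))   ≡⟨ cong (_* perS (suc (2 ℕ.* n))) (-1^[1+2*n]≡-1 n) ⟩
    -1ℤ * perS (suc (2 ℕ.* n))                   ≡⟨ -1*i≡-i (perS (suc (2 ℕ.* n))) ⟩
    - perS (suc (2 ℕ.* n))                       ∎)
    where open ≡-Reasoning

module ShiftedSignMatrix where

  open Permanent
  open BinomialSums
  open SignMatrix
  open Signs
  open import Data.Nat as ℕ using (ℕ; zero; suc; s≤s)
  open import Data.Nat.Properties using (+-suc; +-identityʳ; m≤m+n)
  open import Data.Integer using (ℤ; 0ℤ; 1ℤ; -1ℤ; _+_; _*_; -_; _-_; _^_)
  open import Data.Integer.Properties
    using (-1*i≡-i; ^-zeroˡ; *-identityˡ; *-identityʳ; *-assoc) renaming (+-identityʳ to +-identityʳℤ)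
  open import Data.Integer.Tactic.RingSolver using (solve-∀)
  open import Data.Fin using (Fin; zero; suc; toℕ; punchIn; fromℕ; fromℕ<)
  open import Data.Fin.Properties using (toℕ-fromℕ<)
  open import Data.Fin.Permutation using (Permutation′; _⟨$⟩ʳ_; insert; id)
  open import Data.Product using (_×_; _,_; proj₁; proj₂)
  open import Function using (_∘_)
  open import Relation.Binary.PropositionalEquality
  open import Relation.Nullary using (¬_; contradiction)

  private variable
    N : ℕ

  S-minor : (t : Fin (suc N)) (a b : Fin N) → S (suc N) (punchIn t a) (punchIn t b) ≡ S N a b
  S-minor zero    a       b       = refl
  S-minor (suc t) zero    zero    = refl
  S-minor (suc t) zero    (suc b) = refl
  S-minor (suc t) (suc a) zero    = refl
  S-minor (suc t) (suc a) (suc b) = S-minor t a b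

  diagPrefix : ℕ → ℤ → Matrix N
  diagPrefix zero    σ i       j       = 0ℤ
  diagPrefix (suc k) σ zero    zero    = σ
  diagPrefix (suc k) σ zero    (suc j) = 0ℤ
  diagPrefix (suc k) σ (suc i) zero    = 0ℤ
  diagPrefix (suc k) σ (suc i) (suc j) = diagPrefix k σ i j

  diagPrefix-step : (σ : ℤ) (t i j : Fin N) → ¬ (i ≡ t × j ≡ t) →
                    diagPrefix (suc (toℕ t)) σ i j ≡ diagPrefix (toℕ t) σ i j
  diagPrefix-step σ zero    zero    zero    ¬tt = contradiction (refl , refl) ¬tt
  diagPrefix-step σ zero    zero    (suc j) ¬tt = refl
  diagPrefix-step σ zero    (suc i) zero    ¬tt = refl
  diagPrefix-step σ zero    (suc i) (suc j) ¬tt = refl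
  diagPrefix-step σ (suc t) zero    zero    ¬tt = refl
  diagPrefix-step σ (suc t) zero    (suc j) ¬tt = refl
  diagPrefix-step σ (suc t) (suc i) zero    ¬tt = refl
  diagPrefix-step σ (suc t) (suc i) (suc j) ¬tt =
    diagPrefix-step σ t i j λ (i≡t , j≡t) → ¬tt (cong suc i≡t , cong suc j≡t)

  diagPrefix-new : (σ : ℤ) (t : Fin N) → diagPrefix (suc (toℕ t)) σ t t ≡ σ
  diagPrefix-new σ zero    = refl
  diagPrefix-new σ (suc t) = diagPrefix-new σ t

  diagPrefix-old : (σ : ℤ) (t : Fin N) → diagPrefix (toℕ t) σ t t ≡ 0ℤ
  diagPrefix-old σ zero    = refl
  diagPrefix-old σ (suc t) = diagPrefix-old σ t

  diagPrefix-minor : (σ : ℤ) (t : Fin (suc N)) (a b : Fin N) →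
                     diagPrefix (suc (toℕ t)) σ (punchIn t a) (punchIn t b) ≡ diagPrefix (toℕ t) σ a b
  diagPrefix-minor σ zero    a       b       = refl
  diagPrefix-minor σ (suc t) zero    zero    = refl
  diagPrefix-minor σ (suc t) zero    (suc b) = refl
  diagPrefix-minor σ (suc t) (suc a) zero    = refl
  diagPrefix-minor σ (suc t) (suc a) (suc b) = diagPrefix-minor σ t a b

  S+σI : (N k : ℕ) → ℤ → Matrix N
  S+σI N k σ i j = S N i j + diagPrefix k σ i j

  per-S+σI-step : (σ : ℤ) (t : Fin (suc N)) →
    per (S+σI (suc N) (suc (toℕ t)) σ) ≡ per (S+σI (suc N) (toℕ t) σ) + σ * per (S+σI N (toℕ t) σ)
  per-S+σI-step {N} σ t = begin
    per A
      ≡⟨ per-linear-entry t t A B (λ i j i≢t → same i j (i≢t ∘ proj₁)) (λ j j≢t → same t j (j≢t ∘ proj₂)) ⟩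
    per B + (A t t - B t t) * per (minor t t A)
      ≡⟨ cong₂ (λ d p → per B + d * p) difference (per-cong minor≡) ⟩
    per B + σ * per (S+σI N (toℕ t) σ) ∎
    where
    open ≡-Reasoning
    A B : Matrix (suc N)
    A = S+σI (suc N) (suc (toℕ t)) σ
    B = S+σI (suc N) (toℕ t) σ
    same : ∀ i j → ¬ (i ≡ t × j ≡ t) → A i j ≡ B i j
    same i j ¬tt = cong (_+_ (S (suc N) i j)) (diagPrefix-step σ t i j ¬tt)
    cancel : ∀ s d → (s + d) - (s + 0ℤ) ≡ d
    cancel = solve-∀
    difference : A t t - B t t ≡ σ
    difference = begin
      (S (suc N) t t + diagPrefix (suc (toℕ t)) σ t t) - (S (suc N) t t + diagPrefix (toℕ t) σ t t)
        ≡⟨ cong₂ (λ x y → (S (suc N) t t + x) - (S (suc N) t t + y)) (diagPrefix-new σ t) (diagPrefix-old σ t) ⟩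
      (S (suc N) t t + σ) - (S (suc N) t t + 0ℤ)
        ≡⟨ cancel (S (suc N) t t) σ ⟩
      σ ∎
    minor≡ : ∀ a b → minor t t A a b ≡ S+σI N (toℕ t) σ a b
    minor≡ a b = cong₂ _+_ (S-minor t a b) (diagPrefix-minor σ t a b)

  per-S+σI-closed : (σ : ℤ) → σ * σ ≡ 1ℤ → ∀ k m →
    per (S+σI (k ℕ.+ m) k σ) ≡ σ ^ k * binomialSum k (λ i → σ ^ i * perS (m ℕ.+ i))
  per-S+σI-closed σ σ²≡1 zero m = begin
    per (S+σI m 0 σ)                                   ≡⟨ per-cong (λ i j → +-identityʳℤ (S m i j)) ⟩
    perS m                                             ≡⟨ cong perS (+-identityʳ m) ⟨
    perS (m ℕ.+ 0)                                     ≡⟨ *-identityˡ (perS (m ℕ.+ 0)) ⟨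
    1ℤ * perS (m ℕ.+ 0)                                ≡⟨ binomialSum-zero (λ i → σ ^ i * perS (m ℕ.+ i)) ⟨
    binomialSum 0 (λ i → σ ^ i * perS (m ℕ.+ i))       ≡⟨ *-identityˡ _ ⟨
    1ℤ * binomialSum 0 (λ i → σ ^ i * perS (m ℕ.+ i))  ∎
    where open ≡-Reasoning
  per-S+σI-closed σ σ²≡1 (suc k) m = begin
    per (S+σI (suc (k ℕ.+ m)) (suc k) σ)
      ≡⟨ cong (λ j → per (S+σI (suc (k ℕ.+ m)) (suc j) σ)) t≡k ⟨
    per (S+σI (suc (k ℕ.+ m)) (suc (toℕ t)) σ)
      ≡⟨ per-S+σI-step σ t ⟩
    per (S+σI (suc (k ℕ.+ m)) (toℕ t) σ) + σ * per (S+σI (k ℕ.+ m) (toℕ t) σ)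
      ≡⟨ cong₂ (λ n j → per (S+σI n j σ) + σ * per (S+σI (k ℕ.+ m) j σ)) (sym (+-suc k m)) t≡k ⟩
    per (S+σI (k ℕ.+ suc m) k σ) + σ * per (S+σI (k ℕ.+ m) k σ)
      ≡⟨ cong₂ (λ a b → a + σ * b) (per-S+σI-closed σ σ²≡1 k (suc m)) (per-S+σI-closed σ σ²≡1 k m) ⟩
    σ ^ k * binomialSum k z + σ * (σ ^ k * binomialSum k y)
      ≡⟨ recombine (σ ^ k) (binomialSum k y) (binomialSum k z) ⟩
    σ ^ suc k * (binomialSum k y + σ * binomialSum k z)
      ≡⟨ cong (λ b → σ ^ suc k * (binomialSum k y + b)) shift ⟨
    σ ^ suc k * (binomialSum k y + binomialSum k (y ∘ suc))
      ≡⟨ cong (σ ^ suc k *_) (binomialSum-suc k y) ⟨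
    σ ^ suc k * binomialSum (suc k) y ∎
    where
    open ≡-Reasoning
    t : Fin (suc (k ℕ.+ m))
    t = fromℕ< (s≤s (m≤m+n k m))
    t≡k : toℕ t ≡ k
    t≡k = toℕ-fromℕ< (s≤s (m≤m+n k m))
    y z : ℕ → ℤ
    y i = σ ^ i * perS (m ℕ.+ i)
    z i = σ ^ i * perS (suc m ℕ.+ i)
    shift : binomialSum k (y ∘ suc) ≡ σ * binomialSum k z
    shift = trans (binomialSum-cong k λ i _ → trans (*-assoc σ (σ ^ i) _)
                                                    (cong (λ n → σ * (σ ^ i * perS n)) (+-suc m i)))
                  (binomialSum-*ˡ k σ z)
    expand : ∀ s p b c → (s * p) * (b + s * c) ≡ (s * s) * (p * c) + s * (p * b)
    expand = solve-∀
    recombine : ∀ p b c → p * c + σ * (p * b) ≡ (σ * p) * (b + σ * c)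
    recombine p b c = sym (begin
      (σ * p) * (b + σ * c)            ≡⟨ expand σ p b c ⟩
      (σ * σ) * (p * c) + σ * (p * b)  ≡⟨ cong (λ u → u * (p * c) + σ * (p * b)) σ²≡1 ⟩
      1ℤ * (p * c) + σ * (p * b)       ≡⟨ cong (_+ σ * (p * b)) (*-identityˡ (p * c)) ⟩
      p * c + σ * (p * b)              ∎)

  per-S+σI-full : (σ : ℤ) → σ * σ ≡ 1ℤ → (∀ i → σ ^ i * perS i ≡ perS i) →
                  (N : ℕ) → per (S+σI N N σ) ≡ σ ^ N * binomialSum N perS
  per-S+σI-full σ σ²≡1 σ-invariant N = begin
    per (S+σI N N σ)                              ≡⟨ cong (λ n → per (S+σI n N σ)) (+-identityʳ N) ⟨
    per (S+σI (N ℕ.+ 0) N σ)                      ≡⟨ per-S+σI-closed σ σ²≡1 N 0 ⟩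
    σ ^ N * binomialSum N (λ i → σ ^ i * perS i)  ≡⟨ cong (σ ^ N *_) (binomialSum-cong N λ i _ → σ-invariant i) ⟩
    σ ^ N * binomialSum N perS                    ∎
    where open ≡-Reasoning

  S+I-last : (n : ℕ) (i : Fin (suc n)) → S+σI (suc n) (suc n) 1ℤ i (fromℕ n) ≡ 1ℤ
  S+I-last zero    zero    = refl
  S+I-last (suc n) zero    = refl
  S+I-last (suc n) (suc i) = S+I-last n i

  S-I-first : (n : ℕ) (i : Fin (suc n)) → S+σI (suc n) (suc n) -1ℤ i zero ≡ -1ℤ
  S-I-first n zero    = refl
  S-I-first n (suc i) = refl

  S+I≡S-I-shifted : (n : ℕ) (i : Fin (suc n)) (k : Fin n) →
                    S+σI (suc n) (suc n) 1ℤ i (punchIn (fromℕ n) k) ≡ S+σI (suc n) (suc n) -1ℤ i (suc k)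
  S+I≡S-I-shifted (suc n)       zero          zero    = refl
  S+I≡S-I-shifted (suc n)       (suc zero)    zero    = refl
  S+I≡S-I-shifted (suc (suc n)) (suc (suc i)) zero    = refl
  S+I≡S-I-shifted (suc n)       zero          (suc k) = refl
  S+I≡S-I-shifted (suc n)       (suc i)       (suc k) = S+I≡S-I-shifted n i k

  -- Moving the last column of S + I to the front gives S - I with its first column negated.
  per-S+I≡-per-S-I : (n : ℕ) → per (S+σI (suc n) (suc n) 1ℤ) ≡ - per (S+σI (suc n) (suc n) -1ℤ)
  per-S+I≡-per-S-I n = begin
    per S+I                           ≡⟨ per-permuteColumns ρ S+I ⟨
    per (λ i j → S+I i (ρ ⟨$⟩ʳ j))    ≡⟨ per-cong entries ⟩
    per (λ i j → S-I i j * sign j)    ≡⟨ per-scaleColumns sign S-I ⟩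
    -1ℤ * Πℤ n (λ _ → 1ℤ) * per S-I   ≡⟨ cong (λ p → -1ℤ * p * per S-I) (trans (Πℤ-const n 1ℤ) (^-zeroˡ n)) ⟩
    -1ℤ * per S-I                     ≡⟨ -1*i≡-i (per S-I) ⟩
    - per S-I                         ∎
    where
    open ≡-Reasoning
    S+I S-I : Matrix (suc n)
    S+I = S+σI (suc n) (suc n) 1ℤ
    S-I = S+σI (suc n) (suc n) -1ℤ
    ρ : Permutation′ (suc n)
    ρ = insert zero (fromℕ n) id
    sign : Fin (suc n) → ℤ
    sign zero    = -1ℤ
    sign (suc _) = 1ℤ
    entries : ∀ i j → S+I i (ρ ⟨$⟩ʳ j) ≡ S-I i j * sign j
    entries i zero    = trans (S+I-last n i) (sym (cong (_* -1ℤ) (S-I-first n i)))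
    entries i (suc k) = trans (S+I≡S-I-shifted n i k) (sym (*-identityʳ (S-I i (suc k))))

  binomialSum-perS-even : (n : ℕ) → binomialSum (2 ℕ.* n) perS ≡ δ0 n
  binomialSum-perS-even zero    = refl
  binomialSum-perS-even (suc n) = i≡-i⇒i≡0 (begin
    B                         ≡⟨ trans (cong (_* B) (^-zeroˡ 2n+2)) (*-identityˡ B) ⟨
    1ℤ ^ 2n+2 * B             ≡⟨ per-S+σI-full 1ℤ refl 1-invariant 2n+2 ⟨
    per (S+σI 2n+2 2n+2 1ℤ)   ≡⟨ per-S+I≡-per-S-I (ℕ.pred 2n+2) ⟩
    - per (S+σI 2n+2 2n+2 -1ℤ) ≡⟨ cong -_ (per-S+σI-full -1ℤ refl perS-parity 2n+2) ⟩
    - (-1ℤ ^ 2n+2 * B)        ≡⟨ cong (λ s → - (s * B)) (-1^[2*n]≡1 (suc n)) ⟩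
    - (1ℤ * B)                ≡⟨ cong -_ (*-identityˡ B) ⟩
    - B                       ∎)
    where
    open ≡-Reasoning
    2n+2 : ℕ
    2n+2 = 2 ℕ.* suc n
    B : ℤ
    B = binomialSum 2n+2 perS
    1-invariant : ∀ i → 1ℤ ^ i * perS i ≡ perS i
    1-invariant i = trans (cong (_* perS i) (^-zeroˡ i)) (*-identityˡ (perS i))

module CosineCoefficients where

  open import Data.Nat as ℕ using (ℕ; zero; suc; _≤_; z≤n; s≤s)
  open import Data.Nat.Properties using (*-suc)
  open import Data.Integer using (0ℤ; -1ℤ; _*_; -_; _^_)
  open import Data.Integer.Properties using (-1*i≡-i; *-identityʳ; *-zeroʳ)
  open import Data.Integer.Tactic.RingSolver using (solve-∀)
  open import Function using (_∘_)
  open import Relation.Binary.PropositionalEquality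

  cosCoeff-even : (n : ℕ) → cosCoeff (2 ℕ.* n) ≡ -1ℤ ^ n
  cosCoeff-even zero    = refl
  cosCoeff-even (suc n) = begin
    cosCoeff (2 ℕ.* suc n)        ≡⟨ cong cosCoeff (*-suc 2 n) ⟩
    - cosCoeff (2 ℕ.* n)          ≡⟨ cong -_ (cosCoeff-even n) ⟩
    - (-1ℤ ^ n)                   ≡⟨ -1*i≡-i (-1ℤ ^ n) ⟨
    -1ℤ ^ suc n                   ∎
    where open ≡-Reasoning

  cosCoeff-odd : (n : ℕ) → cosCoeff (suc (2 ℕ.* n)) ≡ 0ℤ
  cosCoeff-odd zero    = refl
  cosCoeff-odd (suc n) = trans (cong (cosCoeff ∘ suc) (*-suc 2 n)) (cong -_ (cosCoeff-odd n))

  sinCoeff-even : (n : ℕ) → sinCoeff (2 ℕ.* n) ≡ 0ℤ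
  sinCoeff-even zero    = refl
  sinCoeff-even (suc n) = trans (cong sinCoeff (*-suc 2 n)) (cong -_ (sinCoeff-even n))

  cosCoeff-reflect : (n k : ℕ) → k ≤ 2 ℕ.* n → cosCoeff (2 ℕ.* n ℕ.∸ k) ≡ -1ℤ ^ n * cosCoeff k
  cosCoeff-reflect zero    zero z≤n    = refl
  cosCoeff-reflect (suc n) k    k≤2n+2 =
    trans (cong (λ m → cosCoeff (m ℕ.∸ k)) (*-suc 2 n)) (reflect k (subst (k ≤_) (*-suc 2 n) k≤2n+2))
    where
    sign-swap : ∀ p c → p * c ≡ (-1ℤ * p) * (- c)
    sign-swap = solve-∀
    reflect : ∀ k → k ≤ suc (suc (2 ℕ.* n)) →
              cosCoeff (suc (suc (2 ℕ.* n)) ℕ.∸ k) ≡ -1ℤ ^ suc n * cosCoeff k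
    reflect zero          _                =
      trans (cong -_ (cosCoeff-even n)) (trans (sym (-1*i≡-i (-1ℤ ^ n))) (sym (*-identityʳ (-1ℤ ^ suc n))))
    reflect (suc zero)    _                = trans (cosCoeff-odd n) (sym (*-zeroʳ (-1ℤ ^ suc n)))
    reflect (suc (suc k)) (s≤s (s≤s k≤2n)) = trans (cosCoeff-reflect n k k≤2n) (sign-swap (-1ℤ ^ n) (cosCoeff k))

module EulerNumbers (E : ℕ → ℤ) (isEuler : IsEulerNumbers E) where

  open Sums
  open BinomialSums
  open SignMatrix
  open ShiftedSignMatrix using (binomialSum-perS-even)
  open CosineCoefficients
  open Signs
  open import Data.Nat as ℕ using (ℕ; zero; suc)
  open import Data.Nat.Combinatorics using (_C_)
  open import Data.Integer using (ℤ; +_; 0ℤ; -1ℤ; _+_; _*_; _^_)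
  open import Data.Integer.Properties using (*-identityˡ; *-zeroʳ; *-assoc; *-comm)
  open import Data.Integer.Tactic.RingSolver using (solve-∀)
  open import Data.Fin using (toℕ)
  open import Relation.Binary.PropositionalEquality

  binomialSum-E·cos : (N : ℕ) → binomialSum N (λ k → E k * cosCoeff (N ℕ.∸ k)) ≡ δ0 N + sinCoeff N
  binomialSum-E·cos N =
    trans (sym (Σℤ≡sum (suc N) (λ k → + (N C toℕ k) * (E (toℕ k) * cosCoeff (N ℕ.∸ toℕ k))))) (isEuler N)

  -- The even-index coefficients of (sec x + tan x) cos x = 1 + sin x.
  binomialSum-E·cos-even : (n : ℕ) → binomialSum (2 ℕ.* n) (λ k → E k * cosCoeff k) ≡ δ0 n
  binomialSum-E·cos-even n = begin
    B                           ≡⟨ trans (cong (_* B) (-1^n*-1^n≡1 n)) (*-identityˡ B) ⟨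
    (-1ℤ ^ n * -1ℤ ^ n) * B     ≡⟨ *-assoc (-1ℤ ^ n) (-1ℤ ^ n) B ⟩
    -1ℤ ^ n * (-1ℤ ^ n * B)     ≡⟨ cong (-1ℤ ^ n *_) reflected ⟩
    -1ℤ ^ n * δ0 n              ≡⟨ sign-δ0 n ⟩
    δ0 n                        ∎
    where
    open ≡-Reasoning
    B : ℤ
    B = binomialSum (2 ℕ.* n) (λ k → E k * cosCoeff k)
    swap : ∀ s e c → s * (e * c) ≡ e * (s * c)
    swap = solve-∀
    δ0-even : ∀ n → δ0 (2 ℕ.* n) + sinCoeff (2 ℕ.* n) ≡ δ0 n
    δ0-even zero    = refl
    δ0-even (suc n) = cong (_+_ 0ℤ) (sinCoeff-even (suc n))
    sign-δ0 : ∀ n → -1ℤ ^ n * δ0 n ≡ δ0 n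
    sign-δ0 zero    = refl
    sign-δ0 (suc n) = *-zeroʳ (-1ℤ ^ suc n)
    reflect : ∀ k → k ℕ.≤ 2 ℕ.* n → -1ℤ ^ n * (E k * cosCoeff k) ≡ E k * cosCoeff (2 ℕ.* n ℕ.∸ k)
    reflect k k≤2n = trans (swap (-1ℤ ^ n) (E k) (cosCoeff k)) (cong (E k *_) (sym (cosCoeff-reflect n k k≤2n)))
    reflected : -1ℤ ^ n * B ≡ δ0 n
    reflected = begin
      -1ℤ ^ n * B
        ≡⟨ binomialSum-*ˡ (2 ℕ.* n) (-1ℤ ^ n) (λ k → E k * cosCoeff k) ⟨
      binomialSum (2 ℕ.* n) (λ k → -1ℤ ^ n * (E k * cosCoeff k))
        ≡⟨ binomialSum-cong (2 ℕ.* n) reflect ⟩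
      binomialSum (2 ℕ.* n) (λ k → E k * cosCoeff (2 ℕ.* n ℕ.∸ k))
        ≡⟨ binomialSum-E·cos (2 ℕ.* n) ⟩
      δ0 (2 ℕ.* n) + sinCoeff (2 ℕ.* n)
        ≡⟨ δ0-even n ⟩
      δ0 n ∎

  perS≡E·cos : ∀ k → perS k ≡ E k * cosCoeff k
  perS≡E·cos = binomialSum-even-injective odd even
    where
    odd : ∀ a → perS (suc (2 ℕ.* a)) ≡ E (suc (2 ℕ.* a)) * cosCoeff (suc (2 ℕ.* a))
    odd a = trans (perS-odd a) (sym (trans (cong (E (suc (2 ℕ.* a)) *_) (cosCoeff-odd a))
                                           (*-zeroʳ (E (suc (2 ℕ.* a))))))
    even : ∀ n → binomialSum (2 ℕ.* n) perS ≡ binomialSum (2 ℕ.* n) (λ k → E k * cosCoeff k)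
    even n = trans (binomialSum-perS-even n) (sym (binomialSum-E·cos-even n))

  perℤ-P-even : (n : ℕ) → perℤ (P (2 ℕ.* n)) ≡ sign^ n * E (2 ℕ.* n)
  perℤ-P-even n = begin
    perℤ (P (2 ℕ.* n))                ≡⟨ perℤ-P≡perS (2 ℕ.* n) ⟩
    perS (2 ℕ.* n)                    ≡⟨ perS≡E·cos (2 ℕ.* n) ⟩
    E (2 ℕ.* n) * cosCoeff (2 ℕ.* n)  ≡⟨ cong (E (2 ℕ.* n) *_) (trans (cosCoeff-even n) (sym (sign^≡-1^ n))) ⟩
    E (2 ℕ.* n) * sign^ n             ≡⟨ *-comm (E (2 ℕ.* n)) (sign^ n) ⟩
    sign^ n * E (2 ℕ.* n)             ∎
    where open ≡-Reasoning

module InverseOfP where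

  open Sums
  open Permanent
  open LaplaceExpansion using (perℤ≡per)
  open SignMatrix using (sgnDiff; P≡S-reversed; P≡sgnDiff)
  open Signs
  open import Data.Nat as ℕ using (ℕ; zero; suc; _<_; s≤s)
  open import Data.Nat.Properties using (*-suc; m+[n∸m]≡n)
  open import Data.Integer using (ℤ; +_; 0ℤ; 1ℤ; -1ℤ; _+_; _*_; -_; _-_; _^_)
  open import Data.Integer.Properties using (+-*-semiring; *-assoc; *-identityˡ; *-zeroʳ; -1*i≡-i; ^-distribˡ-+-*)
  open import Data.Integer.Tactic.RingSolver using (solve-∀)
  open import Data.Fin using (Fin; zero; suc; toℕ; opposite)
  open import Data.Fin.Properties
    using (toℕ<n; toℕ-injective; opposite-prop; opposite-involutive) renaming (_≟_ to _≟F_)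
  open import Function using (_∘_)
  open import Relation.Binary.PropositionalEquality
  open import Relation.Nullary using (yes; no; contradiction)
  open import Algebra.Properties.Semiring.Sum +-*-semiring using (sum; sum-syntax; sum-cong-≗)

  altSum : ℕ → ℤ
  altSum M = ∑[ k < M ] (-1ℤ ^ toℕ k)

  altSum-suc : (M : ℕ) → altSum (suc M) ≡ 1ℤ - altSum M
  altSum-suc M = cong (_+_ 1ℤ) (trans (sum-cong-*ˡ {M} -1ℤ (λ _ → refl)) (-1*i≡-i (altSum M)))

  altSum-even : (n : ℕ) → altSum (2 ℕ.* n) ≡ 0ℤ
  altSum-even zero    = refl
  altSum-even (suc n) = begin
    altSum (2 ℕ.* suc n)            ≡⟨ cong altSum (*-suc 2 n) ⟩
    altSum (suc (suc (2 ℕ.* n)))    ≡⟨ altSum-suc (suc (2 ℕ.* n)) ⟩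
    1ℤ - altSum (suc (2 ℕ.* n))     ≡⟨ cong (_-_ 1ℤ) (altSum-suc (2 ℕ.* n)) ⟩
    1ℤ - (1ℤ - altSum (2 ℕ.* n))    ≡⟨ cong (λ a → 1ℤ - (1ℤ - a)) (altSum-even n) ⟩
    0ℤ                              ∎
    where open ≡-Reasoning

  signedδ : ℕ → ℕ → ℤ
  signedδ zero    zero    = 1ℤ
  signedδ zero    (suc b) = 0ℤ
  signedδ (suc a) zero    = 0ℤ
  signedδ (suc a) (suc b) = - signedδ a b

  signedδ-diagonal : ∀ a → signedδ a a ≡ -1ℤ ^ a
  signedδ-diagonal zero    = refl
  signedδ-diagonal (suc a) = trans (cong -_ (signedδ-diagonal a)) (sym (-1*i≡-i (-1ℤ ^ a)))

  signedδ-off-diagonal : ∀ a b → a ≢ b → signedδ a b ≡ 0ℤ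
  signedδ-off-diagonal zero    zero    a≢b = contradiction refl a≢b
  signedδ-off-diagonal zero    (suc b) a≢b = refl
  signedδ-off-diagonal (suc a) zero    a≢b = refl
  signedδ-off-diagonal (suc a) (suc b) a≢b = cong -_ (signedδ-off-diagonal a b (a≢b ∘ cong suc))

  alternating-sgnDiff : ∀ M b → b < M → ∑[ k < M ] (-1ℤ ^ toℕ k * sgnDiff b (toℕ k)) ≡ 1ℤ - altSum M
  alternating-sgnDiff (suc M) zero    _ = begin
    1ℤ * 0ℤ + ∑[ k < M ] (-1ℤ ^ suc (toℕ k) * -1ℤ)
      ≡⟨ cong (_+_ (1ℤ * 0ℤ)) (sum-cong-*ˡ {M} 1ℤ λ k → flip (-1ℤ ^ toℕ k)) ⟩
    1ℤ * 0ℤ + 1ℤ * altSum M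
      ≡⟨ ring (altSum M) ⟩
    1ℤ - (1ℤ - altSum M)
      ≡⟨ cong (_-_ 1ℤ) (altSum-suc M) ⟨
    1ℤ - altSum (suc M) ∎
    where
    open ≡-Reasoning
    flip : ∀ p → (-1ℤ * p) * -1ℤ ≡ 1ℤ * p
    flip = solve-∀
    ring : ∀ a → 1ℤ * 0ℤ + 1ℤ * a ≡ 1ℤ - (1ℤ - a)
    ring = solve-∀
  alternating-sgnDiff (suc M) (suc b) (s≤s b<M) = begin
    1ℤ * 1ℤ + ∑[ k < M ] (-1ℤ ^ suc (toℕ k) * sgnDiff b (toℕ k))
      ≡⟨ cong (_+_ (1ℤ * 1ℤ)) (sum-cong-*ˡ {M} -1ℤ λ k → *-assoc -1ℤ (-1ℤ ^ toℕ k) (sgnDiff b (toℕ k))) ⟩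
    1ℤ * 1ℤ + -1ℤ * ∑[ k < M ] (-1ℤ ^ toℕ k * sgnDiff b (toℕ k))
      ≡⟨ cong (λ s → 1ℤ * 1ℤ + -1ℤ * s) (alternating-sgnDiff M b b<M) ⟩
    1ℤ * 1ℤ + -1ℤ * (1ℤ - altSum M)  ≡⟨ ring (altSum M) ⟩
    1ℤ - (1ℤ - altSum M)             ≡⟨ cong (_-_ 1ℤ) (altSum-suc M) ⟨
    1ℤ - altSum (suc M)              ∎
    where
    open ≡-Reasoning
    ring : ∀ a → 1ℤ * 1ℤ + -1ℤ * (1ℤ - a) ≡ 1ℤ - (1ℤ - a)
    ring = solve-∀

  alternating-sgnDiff² : ∀ M a b → a < M → b < M →
    ∑[ k < M ] (-1ℤ ^ toℕ k * (sgnDiff a (toℕ k) * sgnDiff b (toℕ k))) ≡ altSum M - signedδ a b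
  alternating-sgnDiff² (suc M) zero zero _ _ = begin
    1ℤ * (0ℤ * 0ℤ) + ∑[ k < M ] (-1ℤ ^ suc (toℕ k) * (-1ℤ * -1ℤ))
      ≡⟨ cong (_+_ (1ℤ * (0ℤ * 0ℤ))) (sum-cong-*ˡ {M} -1ℤ λ k → flip (-1ℤ ^ toℕ k)) ⟩
    1ℤ * (0ℤ * 0ℤ) + -1ℤ * altSum M    ≡⟨ ring (altSum M) ⟩
    (1ℤ - altSum M) - 1ℤ               ≡⟨ cong (_- 1ℤ) (altSum-suc M) ⟨
    altSum (suc M) - 1ℤ                ∎
    where
    open ≡-Reasoning
    flip : ∀ p → (-1ℤ * p) * (-1ℤ * -1ℤ) ≡ -1ℤ * p
    flip = solve-∀
    ring : ∀ a → 1ℤ * (0ℤ * 0ℤ) + -1ℤ * a ≡ (1ℤ - a) - 1ℤ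
    ring = solve-∀
  alternating-sgnDiff² (suc M) zero (suc b) _ (s≤s b<M) = begin
    1ℤ * (0ℤ * 1ℤ) + ∑[ k < M ] (-1ℤ ^ suc (toℕ k) * (-1ℤ * sgnDiff b (toℕ k)))
      ≡⟨ cong (_+_ (1ℤ * (0ℤ * 1ℤ))) (sum-cong-*ˡ {M} 1ℤ λ k → flip (-1ℤ ^ toℕ k) (sgnDiff b (toℕ k))) ⟩
    1ℤ * (0ℤ * 1ℤ) + 1ℤ * ∑[ k < M ] (-1ℤ ^ toℕ k * sgnDiff b (toℕ k))
      ≡⟨ cong (λ s → 1ℤ * (0ℤ * 1ℤ) + 1ℤ * s) (alternating-sgnDiff M b b<M) ⟩
    1ℤ * (0ℤ * 1ℤ) + 1ℤ * (1ℤ - altSum M)  ≡⟨ ring (altSum M) ⟩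
    (1ℤ - altSum M) - 0ℤ                   ≡⟨ cong (_- 0ℤ) (altSum-suc M) ⟨
    altSum (suc M) - 0ℤ                    ∎
    where
    open ≡-Reasoning
    flip : ∀ p s → (-1ℤ * p) * (-1ℤ * s) ≡ 1ℤ * (p * s)
    flip = solve-∀
    ring : ∀ a → 1ℤ * (0ℤ * 1ℤ) + 1ℤ * (1ℤ - a) ≡ (1ℤ - a) - 0ℤ
    ring = solve-∀
  alternating-sgnDiff² (suc M) (suc a) zero (s≤s a<M) _ = begin
    1ℤ * (1ℤ * 0ℤ) + ∑[ k < M ] (-1ℤ ^ suc (toℕ k) * (sgnDiff a (toℕ k) * -1ℤ))
      ≡⟨ cong (_+_ (1ℤ * (1ℤ * 0ℤ))) (sum-cong-*ˡ {M} 1ℤ λ k → flip (-1ℤ ^ toℕ k) (sgnDiff a (toℕ k))) ⟩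
    1ℤ * (1ℤ * 0ℤ) + 1ℤ * ∑[ k < M ] (-1ℤ ^ toℕ k * sgnDiff a (toℕ k))
      ≡⟨ cong (λ s → 1ℤ * (1ℤ * 0ℤ) + 1ℤ * s) (alternating-sgnDiff M a a<M) ⟩
    1ℤ * (1ℤ * 0ℤ) + 1ℤ * (1ℤ - altSum M)  ≡⟨ ring (altSum M) ⟩
    (1ℤ - altSum M) - 0ℤ                   ≡⟨ cong (_- 0ℤ) (altSum-suc M) ⟨
    altSum (suc M) - 0ℤ                    ∎
    where
    open ≡-Reasoning
    flip : ∀ p s → (-1ℤ * p) * (s * -1ℤ) ≡ 1ℤ * (p * s)
    flip = solve-∀
    ring : ∀ a → 1ℤ * (1ℤ * 0ℤ) + 1ℤ * (1ℤ - a) ≡ (1ℤ - a) - 0ℤ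
    ring = solve-∀
  alternating-sgnDiff² (suc M) (suc a) (suc b) (s≤s a<M) (s≤s b<M) = begin
    1ℤ * (1ℤ * 1ℤ) + ∑[ k < M ] (-1ℤ ^ suc (toℕ k) * (sgnDiff a (toℕ k) * sgnDiff b (toℕ k)))
      ≡⟨ cong (_+_ (1ℤ * (1ℤ * 1ℤ))) (sum-cong-*ˡ {M} -1ℤ λ k → *-assoc -1ℤ (-1ℤ ^ toℕ k) _) ⟩
    1ℤ * (1ℤ * 1ℤ) + -1ℤ * ∑[ k < M ] (-1ℤ ^ toℕ k * (sgnDiff a (toℕ k) * sgnDiff b (toℕ k)))
      ≡⟨ cong (λ s → 1ℤ * (1ℤ * 1ℤ) + -1ℤ * s) (alternating-sgnDiff² M a b a<M b<M) ⟩
    1ℤ * (1ℤ * 1ℤ) + -1ℤ * (altSum M - signedδ a b)  ≡⟨ ring (altSum M) (signedδ a b) ⟩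
    (1ℤ - altSum M) - - signedδ a b                  ≡⟨ cong (_- - signedδ a b) (altSum-suc M) ⟨
    altSum (suc M) - - signedδ a b                   ∎
    where
    open ≡-Reasoning
    ring : ∀ a d → 1ℤ * (1ℤ * 1ℤ) + -1ℤ * (a - d) ≡ (1ℤ - a) - - d
    ring = solve-∀

  idℤ : {N : ℕ} → Matrix N
  idℤ i j with i ≟F j
  ... | yes _ = 1ℤ
  ... | no  _ = 0ℤ

  P⁻¹ : (m : ℕ) → Matrix m
  P⁻¹ m i j = -1ℤ ^ toℕ i * (P m i j * -1ℤ ^ toℕ j)

  alternating-P² : (m : ℕ) (i j : Fin m) →
    ∑[ k < m ] (-1ℤ ^ toℕ k * (P m i k * P m k j)) ≡ altSum m - signedδ (toℕ (opposite i)) (toℕ (opposite j))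
  alternating-P² m i j = trans
    (sum-cong-≗ {m} λ k → cong (-1ℤ ^ toℕ k *_) (cong₂ _*_ (P≡sgnDiff m i k) (P≡S-reversed m k j)))
    (alternating-sgnDiff² m _ _ (toℕ<n (opposite i)) (toℕ<n (opposite j)))

  toℕ+toℕ-opposite : (m : ℕ) (i : Fin m) → toℕ i ℕ.+ toℕ (opposite i) ≡ ℕ.pred m
  toℕ+toℕ-opposite m i =
    cong ℕ.pred (trans (cong (suc (toℕ i) ℕ.+_) (opposite-prop i)) (m+[n∸m]≡n (toℕ<n i)))

  -1^pred[2*n]≡-1 : (n : ℕ) → Fin (2 ℕ.* n) → -1ℤ ^ ℕ.pred (2 ℕ.* n) ≡ -1ℤ
  -1^pred[2*n]≡-1 (suc n) _ = trans (cong (λ k → -1ℤ ^ ℕ.pred k) (*-suc 2 n)) (-1^[1+2*n]≡-1 n)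

  -- For even m the alternating sum vanishes, and on the diagonal i + (m - 1 - i) = m - 1 is odd.
  alternating-P²-even : (n : ℕ) (i j x : Fin (2 ℕ.* n)) → (i ≡ j → x ≡ i) →
    -1ℤ ^ toℕ x * (altSum (2 ℕ.* n) - signedδ (toℕ (opposite i)) (toℕ (opposite j))) ≡ idℤ i j
  alternating-P²-even n i j x x≡i with i ≟F j
  ... | no i≢j = begin
    -1ℤ ^ toℕ x * (altSum (2 ℕ.* n) - signedδ (toℕ (opposite i)) (toℕ (opposite j)))
      ≡⟨ cong₂ (λ a d → -1ℤ ^ toℕ x * (a - d)) (altSum-even n)
               (signedδ-off-diagonal _ _ (i≢j ∘ opposite-injective)) ⟩
    -1ℤ ^ toℕ x * 0ℤ
      ≡⟨ *-zeroʳ (-1ℤ ^ toℕ x) ⟩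
    0ℤ ∎
    where
    open ≡-Reasoning
    opposite-injective : toℕ (opposite i) ≡ toℕ (opposite j) → i ≡ j
    opposite-injective eq = begin
      i                     ≡⟨ opposite-involutive i ⟨
      opposite (opposite i) ≡⟨ cong opposite (toℕ-injective eq) ⟩
      opposite (opposite j) ≡⟨ opposite-involutive j ⟩
      j                     ∎
  ... | yes refl rewrite x≡i refl = begin
    -1ℤ ^ toℕ i * (altSum (2 ℕ.* n) - signedδ (toℕ (opposite i)) (toℕ (opposite i)))
      ≡⟨ cong₂ (λ a d → -1ℤ ^ toℕ i * (a - d)) (altSum-even n) (signedδ-diagonal (toℕ (opposite i))) ⟩
    -1ℤ ^ toℕ i * (0ℤ - -1ℤ ^ toℕ (opposite i))   ≡⟨ negate (-1ℤ ^ toℕ i) (-1ℤ ^ toℕ (opposite i)) ⟩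
    - (-1ℤ ^ toℕ i * -1ℤ ^ toℕ (opposite i))      ≡⟨ cong -_ (^-distribˡ-+-* -1ℤ (toℕ i) (toℕ (opposite i))) ⟨
    - -1ℤ ^ (toℕ i ℕ.+ toℕ (opposite i))          ≡⟨ cong (λ k → - -1ℤ ^ k) (toℕ+toℕ-opposite (2 ℕ.* n) i) ⟩
    - -1ℤ ^ ℕ.pred (2 ℕ.* n)                       ≡⟨ cong -_ (-1^pred[2*n]≡-1 n i) ⟩
    1ℤ ∎
    where
    open ≡-Reasoning
    negate : ∀ a b → a * (0ℤ - b) ≡ - (a * b)
    negate = solve-∀

  P*P⁻¹≡I : (n : ℕ) (i j : Fin (2 ℕ.* n)) → ∑[ k < 2 ℕ.* n ] (P (2 ℕ.* n) i k * P⁻¹ (2 ℕ.* n) k j) ≡ idℤ i j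
  P*P⁻¹≡I n i j = begin
    ∑[ k < m ] (P m i k * (-1ℤ ^ toℕ k * (P m k j * -1ℤ ^ toℕ j)))
      ≡⟨ sum-cong-*ˡ {m} (-1ℤ ^ toℕ j) (λ k → rearrange (P m i k) (-1ℤ ^ toℕ k) (P m k j) (-1ℤ ^ toℕ j)) ⟩
    -1ℤ ^ toℕ j * ∑[ k < m ] (-1ℤ ^ toℕ k * (P m i k * P m k j))
      ≡⟨ cong (-1ℤ ^ toℕ j *_) (alternating-P² m i j) ⟩
    -1ℤ ^ toℕ j * (altSum m - signedδ (toℕ (opposite i)) (toℕ (opposite j)))
      ≡⟨ alternating-P²-even n i j j sym ⟩
    idℤ i j ∎
    where
    open ≡-Reasoning
    m : ℕ
    m = 2 ℕ.* n
    rearrange : ∀ a s b t → a * (s * (b * t)) ≡ t * (s * (a * b))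
    rearrange = solve-∀

  P⁻¹*P≡I : (n : ℕ) (i j : Fin (2 ℕ.* n)) → ∑[ k < 2 ℕ.* n ] (P⁻¹ (2 ℕ.* n) i k * P (2 ℕ.* n) k j) ≡ idℤ i j
  P⁻¹*P≡I n i j = begin
    ∑[ k < m ] ((-1ℤ ^ toℕ i * (P m i k * -1ℤ ^ toℕ k)) * P m k j)
      ≡⟨ sum-cong-*ˡ {m} (-1ℤ ^ toℕ i) (λ k → rearrange (-1ℤ ^ toℕ i) (P m i k) (-1ℤ ^ toℕ k) (P m k j)) ⟩
    -1ℤ ^ toℕ i * ∑[ k < m ] (-1ℤ ^ toℕ k * (P m i k * P m k j))
      ≡⟨ cong (-1ℤ ^ toℕ i *_) (alternating-P² m i j) ⟩
    -1ℤ ^ toℕ i * (altSum m - signedδ (toℕ (opposite i)) (toℕ (opposite j)))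
      ≡⟨ alternating-P²-even n i j i (λ _ → refl) ⟩
    idℤ i j ∎
    where
    open ≡-Reasoning
    m : ℕ
    m = 2 ℕ.* n
    rearrange : ∀ t a s b → (t * (a * s)) * b ≡ t * (s * (a * b))
    rearrange = solve-∀

  Πℤ-square : (N : ℕ) (s : Fin N → ℤ) → (∀ i → s i * s i ≡ 1ℤ) → Πℤ N s * Πℤ N s ≡ 1ℤ
  Πℤ-square zero    s s²≡1 = refl
  Πℤ-square (suc N) s s²≡1 = begin
    (s zero * Πℤ N (s ∘ suc)) * (s zero * Πℤ N (s ∘ suc))
      ≡⟨ interchange (s zero) (Πℤ N (s ∘ suc)) (s zero) (Πℤ N (s ∘ suc)) ⟩
    (s zero * s zero) * (Πℤ N (s ∘ suc) * Πℤ N (s ∘ suc))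
      ≡⟨ cong₂ _*_ (s²≡1 zero) (Πℤ-square N (s ∘ suc) (s²≡1 ∘ suc)) ⟩
    1ℤ ∎
    where
    open ≡-Reasoning
    interchange : ∀ a b c d → (a * b) * (c * d) ≡ (a * c) * (b * d)
    interchange = solve-∀

  per-P⁻¹ : (m : ℕ) → per (P⁻¹ m) ≡ per (P m)
  per-P⁻¹ m = begin
    per (λ i j → alt i * (P m i j * alt j))      ≡⟨ per-scaleRows alt (λ i j → P m i j * alt j) ⟩
    Πℤ m alt * per (λ i j → P m i j * alt j)     ≡⟨ cong (Πℤ m alt *_) (per-scaleColumns alt (P m)) ⟩
    Πℤ m alt * (Πℤ m alt * per (P m))            ≡⟨ *-assoc (Πℤ m alt) (Πℤ m alt) (per (P m)) ⟨
    (Πℤ m alt * Πℤ m alt) * per (P m)            ≡⟨ cong (_* per (P m)) (Πℤ-square m alt (-1^n*-1^n≡1 ∘ toℕ)) ⟩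
    1ℤ * per (P m)                               ≡⟨ *-identityˡ (per (P m)) ⟩
    per (P m)                                    ∎
    where
    open ≡-Reasoning
    alt : Fin m → ℤ
    alt i = -1ℤ ^ toℕ i

  perℤ-P⁻¹ : (m : ℕ) → perℤ (P⁻¹ m) ≡ perℤ (P m)
  perℤ-P⁻¹ m = trans (perℤ≡per (P⁻¹ m)) (trans (per-P⁻¹ m) (sym (perℤ≡per (P m))))

module Rationals where

  open Permanent using (Matrix)
  open InverseOfP using (idℤ)
  open import Data.Nat using (ℕ; zero; suc)
  open import Data.Integer as ℤ using (ℤ; +_)
  open import Data.Integer.Properties using (+-*-semiring)
  open import Data.Integer.Tactic.RingSolver using (solve-∀)
  open import Data.Rational as ℚ using (ℚ; mkℚ; 0ℚ; 1ℚ)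
  open import Data.Rational.Properties as ℚP using (↥p/↧p≡p; +-*-ring)
  open import Data.Nat.Coprimality using (1-coprimeTo) renaming (sym to coprime-sym)
  open import Data.Fin using (Fin; zero; suc; punchIn)
  open import Data.Fin.Properties using (punchInᵢ≢i) renaming (_≟_ to _≟F_)
  open import Data.List using (List; []; _∷_; foldr)
  open import Data.Product using (_,_)
  open import Algebra.Bundles using (Ring)
  open import Function using (_∘_)
  open import Relation.Binary.PropositionalEquality
  open import Relation.Nullary using (yes; no; contradiction)
  import Algebra.Properties.Semiring.Sum as SemiringSum
  open SemiringSum +-*-semiring using () renaming (sum to ∑ℤ)
  open SemiringSum (Ring.semiring +-*-ring)
    using (sum; sum-syntax; sum-cong-≗; ∑-comm; *-distribˡ-sum; *-distribʳ-sum; sum-remove; sum-replicate-zero)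

  private variable
    N : ℕ

  -- On the normal form mkℚ z 0 _, ℚ's _+_ and _*_ reduce to ℤ arithmetic over the denominator 1.
  toℚ≡mkℚ : (z : ℤ) → toℚ z ≡ mkℚ z 0 (coprime-sym (1-coprimeTo _))
  toℚ≡mkℚ z = ↥p/↧p≡p (mkℚ z 0 (coprime-sym (1-coprimeTo _)))

  toℚ-homo-+ : (a b : ℤ) → toℚ (a ℤ.+ b) ≡ toℚ a ℚ.+ toℚ b
  toℚ-homo-+ a b = trans (cong toℚ (times-one a b)) (sym (cong₂ ℚ._+_ (toℚ≡mkℚ a) (toℚ≡mkℚ b)))
    where
    times-one : ∀ a b → a ℤ.+ b ≡ a ℤ.* + 1 ℤ.+ b ℤ.* + 1
    times-one = solve-∀

  toℚ-homo-* : (a b : ℤ) → toℚ (a ℤ.* b) ≡ toℚ a ℚ.* toℚ b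
  toℚ-homo-* a b = sym (cong₂ ℚ._*_ (toℚ≡mkℚ a) (toℚ≡mkℚ b))

  Σℚ-cong : {f g : Fin N → ℚ} → (∀ i → f i ≡ g i) → Σℚ N f ≡ Σℚ N g
  Σℚ-cong {zero}  f≗g = refl
  Σℚ-cong {suc N} f≗g = cong₂ ℚ._+_ (f≗g zero) (Σℚ-cong (f≗g ∘ suc))

  Πℚ-cong : {f g : Fin N → ℚ} → (∀ i → f i ≡ g i) → Πℚ N f ≡ Πℚ N g
  Πℚ-cong {zero}  f≗g = refl
  Πℚ-cong {suc N} f≗g = cong₂ ℚ._*_ (f≗g zero) (Πℚ-cong (f≗g ∘ suc))

  Σℚ-toℚ : (N : ℕ) (f : Fin N → ℤ) → Σℚ N (toℚ ∘ f) ≡ toℚ (∑ℤ f)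
  Σℚ-toℚ zero    f = refl
  Σℚ-toℚ (suc N) f = trans (cong (toℚ (f zero) ℚ.+_) (Σℚ-toℚ N (f ∘ suc))) (sym (toℚ-homo-+ (f zero) _))

  Πℚ-toℚ : (N : ℕ) (f : Fin N → ℤ) → Πℚ N (toℚ ∘ f) ≡ toℚ (Πℤ N f)
  Πℚ-toℚ zero    f = refl
  Πℚ-toℚ (suc N) f = trans (cong (toℚ (f zero) ℚ.*_) (Πℚ-toℚ N (f ∘ suc))) (sym (toℚ-homo-* (f zero) _))

  perℚ-cong : {A B : Fin N → Fin N → ℚ} → (∀ i j → A i j ≡ B i j) → perℚ A ≡ perℚ B
  perℚ-cong {N} {A} {B} A≗B = go (perms N)
    where
    go : (πs : List (Fin N → Fin N)) →
         foldr (λ π acc → Πℚ N (λ i → A i (π i)) ℚ.+ acc) 0ℚ πs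
           ≡ foldr (λ π acc → Πℚ N (λ i → B i (π i)) ℚ.+ acc) 0ℚ πs
    go []       = refl
    go (π ∷ πs) = cong₂ ℚ._+_ (Πℚ-cong λ i → A≗B i (π i)) (go πs)

  perℚ-toℚ : (A : Matrix N) → perℚ (λ i j → toℚ (A i j)) ≡ toℚ (perℤ A)
  perℚ-toℚ {N} A = go (perms N)
    where
    Π[A] : (Fin N → Fin N) → ℤ
    Π[A] π = Πℤ N (λ i → A i (π i))
    go : (πs : List (Fin N → Fin N)) →
         foldr (λ π acc → Πℚ N (λ i → toℚ (A i (π i))) ℚ.+ acc) 0ℚ πs
           ≡ toℚ (foldr (λ π acc → Π[A] π ℤ.+ acc) (+ 0) πs)
    go []       = refl
    go (π ∷ πs) = trans (cong₂ ℚ._+_ (Πℚ-toℚ N (λ i → A i (π i))) (go πs)) (sym (toℚ-homo-+ (Π[A] π) _))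

  Σℚ≡sum : (N : ℕ) (f : Fin N → ℚ) → Σℚ N f ≡ sum f
  Σℚ≡sum zero    f = refl
  Σℚ≡sum (suc N) f = cong (f zero ℚ.+_) (Σℚ≡sum N (f ∘ suc))

  mulℚ≡sum : (A B : Fin N → Fin N → ℚ) (i j : Fin N) → mulℚ A B i j ≡ ∑[ k < N ] (A i k ℚ.* B k j)
  mulℚ≡sum {N} A B i j = Σℚ≡sum N (λ k → A i k ℚ.* B k j)

  mulℚ-toℚ : (A B : Matrix N) (i j : Fin N) →
             mulℚ (λ i j → toℚ (A i j)) (λ i j → toℚ (B i j)) i j ≡ toℚ (∑ℤ (λ k → A i k ℤ.* B k j))
  mulℚ-toℚ {N} A B i j =
    trans (Σℚ-cong λ k → sym (toℚ-homo-* (A i k) (B k j))) (Σℚ-toℚ N (λ k → A i k ℤ.* B k j))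

  idℚ-diagonal : (i : Fin N) → idℚ i i ≡ 1ℚ
  idℚ-diagonal i with i ≟F i
  ... | yes _  = refl
  ... | no i≢i = contradiction refl i≢i

  idℚ-off-diagonal : {i j : Fin N} → i ≢ j → idℚ i j ≡ 0ℚ
  idℚ-off-diagonal {i = i} {j} i≢j with i ≟F j
  ... | yes i≡j = contradiction i≡j i≢j
  ... | no  _   = refl

  idℚ-symmetric : (i j : Fin N) → idℚ i j ≡ idℚ j i
  idℚ-symmetric i j with i ≟F j | j ≟F i
  ... | yes _   | yes _   = refl
  ... | no  _   | no  _   = refl
  ... | yes i≡j | no  j≢i = contradiction (sym i≡j) j≢i
  ... | no  i≢j | yes j≡i = contradiction (sym j≡i) i≢j

  idℚ≡toℚ-idℤ : (i j : Fin N) → idℚ i j ≡ toℚ (idℤ i j)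
  idℚ≡toℚ-idℤ i j with i ≟F j
  ... | yes _ = refl
  ... | no  _ = refl

  ∑-idℚ-selectˡ : (i : Fin N) (f : Fin N → ℚ) → ∑[ k < N ] (idℚ i k ℚ.* f k) ≡ f i
  ∑-idℚ-selectˡ {suc N} i f = begin
    ∑[ k < suc N ] (idℚ i k ℚ.* f k)
      ≡⟨ sum-remove {i = i} (λ k → idℚ i k ℚ.* f k) ⟩
    idℚ i i ℚ.* f i ℚ.+ ∑[ k < N ] (idℚ i (punchIn i k) ℚ.* f (punchIn i k))
      ≡⟨ cong₂ ℚ._+_ (trans (cong (ℚ._* f i) (idℚ-diagonal i)) (ℚP.*-identityˡ (f i)))
                     (sum-cong-≗ {N} off-diagonal) ⟩
    f i ℚ.+ ∑[ k < N ] 0ℚ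
      ≡⟨ cong (f i ℚ.+_) (sum-replicate-zero N) ⟩
    f i ℚ.+ 0ℚ
      ≡⟨ ℚP.+-identityʳ (f i) ⟩
    f i ∎
    where
    open ≡-Reasoning
    off-diagonal : ∀ k → idℚ i (punchIn i k) ℚ.* f (punchIn i k) ≡ 0ℚ
    off-diagonal k = trans (cong (ℚ._* f (punchIn i k)) (idℚ-off-diagonal (punchInᵢ≢i i k ∘ sym)))
                           (ℚP.*-zeroˡ (f (punchIn i k)))

  ∑-idℚ-selectʳ : (j : Fin N) (f : Fin N → ℚ) → ∑[ k < N ] (f k ℚ.* idℚ k j) ≡ f j
  ∑-idℚ-selectʳ {N} j f = trans (sum-cong-≗ {N} commute) (∑-idℚ-selectˡ j f)
    where
    commute : ∀ k → f k ℚ.* idℚ k j ≡ idℚ j k ℚ.* f k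
    commute k = trans (ℚP.*-comm (f k) (idℚ k j)) (cong (ℚ._* f k) (idℚ-symmetric k j))

  mulℚ-assoc : (A B C : Fin N → Fin N → ℚ) (i j : Fin N) →
               mulℚ (mulℚ A B) C i j ≡ mulℚ A (mulℚ B C) i j
  mulℚ-assoc {N} A B C i j = begin
    mulℚ (mulℚ A B) C i j
      ≡⟨ trans (mulℚ≡sum (mulℚ A B) C i j) (sum-cong-≗ {N} λ k → cong (ℚ._* C k j) (mulℚ≡sum A B i k)) ⟩
    ∑[ k < N ] (∑[ l < N ] (A i l ℚ.* B l k) ℚ.* C k j)
      ≡⟨ sum-cong-≗ {N} (λ k → *-distribʳ-sum (C k j) (λ l → A i l ℚ.* B l k)) ⟩
    ∑[ k < N ] ∑[ l < N ] ((A i l ℚ.* B l k) ℚ.* C k j)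
      ≡⟨ ∑-comm (λ k l → (A i l ℚ.* B l k) ℚ.* C k j) ⟩
    ∑[ l < N ] ∑[ k < N ] ((A i l ℚ.* B l k) ℚ.* C k j)
      ≡⟨ sum-cong-≗ {N} (λ l → sum-cong-≗ {N} λ k → ℚP.*-assoc (A i l) (B l k) (C k j)) ⟩
    ∑[ l < N ] ∑[ k < N ] (A i l ℚ.* (B l k ℚ.* C k j))
      ≡⟨ sum-cong-≗ {N} (λ l → *-distribˡ-sum (A i l) (λ k → B l k ℚ.* C k j)) ⟨
    ∑[ l < N ] (A i l ℚ.* ∑[ k < N ] (B l k ℚ.* C k j))
      ≡⟨ trans (sum-cong-≗ {N} λ l → cong (A i l ℚ.*_) (sym (mulℚ≡sum B C l j)))
               (sym (mulℚ≡sum A (mulℚ B C) i j)) ⟩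
    mulℚ A (mulℚ B C) i j ∎
    where open ≡-Reasoning

  inverse-unique : {Q R R′ : Fin N → Fin N → ℚ} → IsInverse Q R → IsInverse Q R′ → ∀ i j → R i j ≡ R′ i j
  inverse-unique {N} {Q} {R} {R′} (_ , RQ≡I) (QR′≡I , _) i j = begin
    R i j
      ≡⟨ ∑-idℚ-selectʳ j (R i) ⟨
    ∑[ k < N ] (R i k ℚ.* idℚ k j)
      ≡⟨ trans (sum-cong-≗ {N} λ k → cong (R i k ℚ.*_) (sym (QR′≡I k j))) (sym (mulℚ≡sum R (mulℚ Q R′) i j)) ⟩
    mulℚ R (mulℚ Q R′) i j
      ≡⟨ mulℚ-assoc R Q R′ i j ⟨
    mulℚ (mulℚ R Q) R′ i j
      ≡⟨ trans (mulℚ≡sum (mulℚ R Q) R′ i j) (sum-cong-≗ {N} λ k → cong (ℚ._* R′ k j) (RQ≡I i k)) ⟩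
    ∑[ k < N ] (idℚ i k ℚ.* R′ k j)
      ≡⟨ ∑-idℚ-selectˡ i (λ k → R′ k j) ⟩
    R′ i j ∎
    where open ≡-Reasoning

  toℚ-isInverse : (A B : Matrix N) →
    (∀ i j → ∑ℤ (λ k → A i k ℤ.* B k j) ≡ idℤ i j) → (∀ i j → ∑ℤ (λ k → B i k ℤ.* A k j) ≡ idℤ i j) →
    IsInverse (λ i j → toℚ (A i j)) (λ i j → toℚ (B i j))
  toℚ-isInverse A B AB≡I BA≡I =
    (λ i j → trans (mulℚ-toℚ A B i j) (trans (cong toℚ (AB≡I i j)) (sym (idℚ≡toℚ-idℤ i j)))) ,
    (λ i j → trans (mulℚ-toℚ B A i j) (trans (cong toℚ (BA≡I i j)) (sym (idℚ≡toℚ-idℤ i j))))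

  perℚ-inverse : {Q R : Fin N → Fin N → ℚ} (A : Matrix N) →
                 IsInverse Q R → IsInverse Q (λ i j → toℚ (A i j)) → perℚ R ≡ toℚ (perℤ A)
  perℚ-inverse {Q = Q} {R} A R-inverse A-inverse =
    trans (perℚ-cong {A = R} (inverse-unique {Q = Q} R-inverse A-inverse)) (perℚ-toℚ A)

open InverseOfP using (P⁻¹; P*P⁻¹≡I; P⁻¹*P≡I; perℤ-P⁻¹)
open Rationals using (toℚ-isInverse; perℚ-inverse)

open import Data.Nat using (ℕ; suc; _*_)
open import Data.Fin using (Fin)
open import Data.Rational using (ℚ)
open import Data.Integer using (ℤ)
import Data.Integer
open import Data.Product using (Σ; _×_; _,_)
open import Relation.Binary.PropositionalEquality using (_≡_; cong; module ≡-Reasoning)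

mainTheorem4 : (E : ℕ → ℤ) → IsEulerNumbers E → (n : ℕ) →
  let m = 2 * suc n
      Q = λ i j → toℚ (P m i j)
  in Σ (Fin m → Fin m → ℚ) (λ R → IsInverse Q R)
     × perℤ (P m) ≡ sign^ (suc n) Data.Integer.* E m
     × ((R : Fin m → Fin m → ℚ) → IsInverse Q R →
          perℚ R ≡ toℚ (sign^ (suc n) Data.Integer.* E m))
mainTheorem4 E isEuler n = (P⁻¹ℚ , P-inverse) , perℤ-P-even (suc n) , per-inverse
  where
  open EulerNumbers E isEuler using (perℤ-P-even)
  m : ℕ
  m = 2 * suc n
  Pℚ P⁻¹ℚ : Fin m → Fin m → ℚ
  Pℚ i j = toℚ (P m i j)
  P⁻¹ℚ i j = toℚ (P⁻¹ m i j)
  P-inverse : IsInverse Pℚ P⁻¹ℚ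
  P-inverse = toℚ-isInverse (P m) (P⁻¹ m) (P*P⁻¹≡I (suc n)) (P⁻¹*P≡I (suc n))
  per-inverse : (R : Fin m → Fin m → ℚ) → IsInverse Pℚ R → perℚ R ≡ toℚ (sign^ (suc n) Data.Integer.* E m)
  per-inverse R R-inverse = begin
    perℚ R                                  ≡⟨ perℚ-inverse {Q = Pℚ} {R} (P⁻¹ m) R-inverse P-inverse ⟩
    toℚ (perℤ (P⁻¹ m))                      ≡⟨ cong toℚ (perℤ-P⁻¹ m) ⟩
    toℚ (perℤ (P m))                        ≡⟨ cong toℚ (perℤ-P-even (suc n)) ⟩
    toℚ (sign^ (suc n) Data.Integer.* E m)  ∎
    where open ≡-Reasoning
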